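{- $\mathbf{C}_\times$ proves that the graphs of addition and multiplication on $\omega$ exist as sets, and that $V_\omega$ exists.
   Context: $\mathbf{C}_\times$ has the axioms: Extensionality; Pair; Union; Infinity (there exists a limit ordinal, an ordinal being a transitive set of transitive sets); $\Delta_0$ Separation; Regularity; Transitive Closure; Cartesian Product (for all $x,y$ the set $x\times y$ exists); Axiom Beta (for every set $X$ and well founded relation $R$ on $X$ there are a transitive $Y$ and $\pi:X\to Y$ with $\pi(u)=\{\pi(v):v\in X\wedge\langle v,u\rangle\in R\}$ for all $u\in X$). $V_\omega$ is the set of hereditarily finite sets. -}

module Defs where

open import Data.Nat using (ℕ; suc)
open import Data.Fin using (Fin)
open import Data.Vec using (Vec; lookup; _∷_)
open import Data.Product using (Σ; _×_; _,_)
open import Data.Sum using (_⊎_)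
open import Data.Empty using (⊥)
open import Relation.Nullary using (¬_)
open import Relation.Binary.PropositionalEquality using (_≡_)

_⟺_ : Set → Set → Set
A ⟺ B = (A → B) × (B → A)
infix 2 _⟺_

LEM : Set₁
LEM = (P : Set) → P ⊎ ¬ P

-- An ∈-structure: a candidate model of a first-order set theory.
-- Equality of the object language is interpreted as Agda's ≡.
record Structure : Set₁ where
  field
    M   : Set
    _∈_ : M → M → Set

-- Δ₀ formulas with n free variables (de Bruijn, variable 0 = most recent).
data Fm (n : ℕ) : Set where
  _∈̇_ : Fin n → Fin n → Fm n
  _≐_ : Fin n → Fin n → Fm n
  ⊥̇   : Fm n
  _⇒̇_ : Fm n → Fm n → Fm n
  _∧̇_ : Fm n → Fm n → Fm n
  _∨̇_ : Fm n → Fm n → Fm n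
  ∀∈  : Fin n → Fm (suc n) → Fm n
  ∃∈  : Fin n → Fm (suc n) → Fm n

module _ (S : Structure) where
  open Structure S

  ⟦_⟧ : {n : ℕ} → Fm n → Vec M n → Set
  ⟦ i ∈̇ j ⟧ ρ = lookup ρ i ∈ lookup ρ j
  ⟦ i ≐ j ⟧ ρ = lookup ρ i ≡ lookup ρ j
  ⟦ ⊥̇ ⟧ ρ = ⊥
  ⟦ φ ⇒̇ ψ ⟧ ρ = ⟦ φ ⟧ ρ → ⟦ ψ ⟧ ρ
  ⟦ φ ∧̇ ψ ⟧ ρ = ⟦ φ ⟧ ρ × ⟦ ψ ⟧ ρ
  ⟦ φ ∨̇ ψ ⟧ ρ = ⟦ φ ⟧ ρ ⊎ ⟦ ψ ⟧ ρ
  ⟦ ∀∈ i φ ⟧ ρ = (z : M) → z ∈ lookup ρ i → ⟦ φ ⟧ (z ∷ ρ)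
  ⟦ ∃∈ i φ ⟧ ρ = Σ M λ z → z ∈ lookup ρ i × ⟦ φ ⟧ (z ∷ ρ)

  _⊆_ : M → M → Set
  x ⊆ y = (z : M) → z ∈ x → z ∈ y

  Empty : M → Set
  Empty x = (z : M) → ¬ (z ∈ x)

  Transitive : M → Set
  Transitive t = (y : M) → y ∈ t → y ⊆ t

  Ordinal : M → Set
  Ordinal a = Transitive a × ((y : M) → y ∈ a → Transitive y)

  IsSucc : M → M → Set
  IsSucc s a = (z : M) → z ∈ s ⟺ (z ∈ a ⊎ z ≡ a)

  LimitOrdinal : M → Set
  LimitOrdinal l = Ordinal l × ¬ Empty l × ¬ (Σ M λ a → IsSucc l a)

  IsPair : M → M → M → Set
  IsPair p x y = (z : M) → z ∈ p ⟺ (z ≡ x ⊎ z ≡ y)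

  IsOPair : M → M → M → Set
  IsOPair o x y = (z : M) → z ∈ o ⟺ (IsPair z x x ⊎ IsPair z x y)

  IsUnion : M → M → Set
  IsUnion u x = (z : M) → z ∈ u ⟺ Σ M λ y → y ∈ x × z ∈ y

  IsProduct : M → M → M → Set
  IsProduct c a b = (z : M) → z ∈ c ⟺
    Σ M λ x → Σ M λ y → x ∈ a × y ∈ b × IsOPair z x y

  Rel : M → M → M → Set
  Rel r x y = Σ M λ z → IsOPair z x y × z ∈ r

  IsFunction : M → M → M → Set
  IsFunction f a b =
    ((z : M) → z ∈ f → Σ M λ x → Σ M λ y → x ∈ a × y ∈ b × IsOPair z x y)
    × ((x : M) → x ∈ a → Σ M λ y → Rel f x y)
    × ((x y y' : M) → Rel f x y → Rel f x y' → y ≡ y')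

  IsBijection : M → M → M → Set
  IsBijection f a b = IsFunction f a b
    × ((x x' y : M) → Rel f x y → Rel f x' y → x ≡ x')
    × ((y : M) → y ∈ b → Σ M λ x → Rel f x y)

  IsTC : M → M → Set
  IsTC x t = Transitive t × x ⊆ t × ((s : M) → Transitive s → x ⊆ s → t ⊆ s)

  WFRelOn : M → M → Set
  WFRelOn r X =
    ((z : M) → z ∈ r → Σ M λ u → Σ M λ v → u ∈ X × v ∈ X × IsOPair z u v)
    × ((y : M) → y ⊆ X → ¬ Empty y →
         Σ M λ m → m ∈ y × ((v : M) → v ∈ y → ¬ Rel r v m))

  record IsCx : Set where
    field
      extensionality : (x y : M) → ((z : M) → z ∈ x ⟺ z ∈ y) → x ≡ y
      pair           : (x y : M) → Σ M λ p → IsPair p x y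
      union          : (x : M) → Σ M λ u → IsUnion u x
      infinity       : Σ M λ l → LimitOrdinal l
      Δ₀-separation  : (n : ℕ) (φ : Fm (suc n)) (ρ : Vec M n) (a : M) →
                       Σ M λ b → (z : M) → z ∈ b ⟺ (z ∈ a × ⟦ φ ⟧ (z ∷ ρ))
      regularity     : (x : M) → ¬ Empty x →
                       Σ M λ y → y ∈ x × ((z : M) → z ∈ y → ¬ (z ∈ x))
      transitive-closure : (x : M) → Σ M λ t → IsTC x t
      cartesian-product  : (x y : M) → Σ M λ c → IsProduct c x y
      beta : (X r : M) → WFRelOn r X →
             Σ M λ Y → Transitive Y × Σ M λ π → IsFunction π X Y ×
               ((u w : M) → u ∈ X → Rel π u w →
                 (z : M) → z ∈ w ⟺ Σ M λ v → v ∈ X × Rel r v u × Rel π v z)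

  NaturalNumber : M → Set
  NaturalNumber n = Ordinal n ×
    ((a : M) → (a ∈ n ⊎ a ≡ n) → Empty a ⊎ Σ M λ b → IsSucc a b)

  IsOmega : M → Set
  IsOmega w = (z : M) → z ∈ w ⟺ NaturalNumber z

  Rel₂ : M → M → M → M → Set
  Rel₂ g m n k = Σ M λ p → IsOPair p m n × Rel g p k

  IsBinOpGraph : M → M → Set
  IsBinOpGraph w g =
    ((z : M) → z ∈ g → Σ M λ m → Σ M λ n → Σ M λ k →
       m ∈ w × n ∈ w × k ∈ w × Σ M λ p → IsOPair p m n × IsOPair z p k)
    × ((m n : M) → m ∈ w → n ∈ w → Σ M λ k → Rel₂ g m n k)
    × ((m n k k' : M) → Rel₂ g m n k → Rel₂ g m n k' → k ≡ k')

  IsAddGraph : M → M → Set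
  IsAddGraph w A = IsBinOpGraph w A
    × ((m e : M) → m ∈ w → Empty e → Rel₂ A m e m)
    × ((m n n' k k' : M) → m ∈ w → n ∈ w → IsSucc n' n → IsSucc k' k →
         Rel₂ A m n k → Rel₂ A m n' k')

  IsMulGraph : M → M → M → Set
  IsMulGraph w A P = IsBinOpGraph w P
    × ((m e : M) → m ∈ w → Empty e → Rel₂ P m e e)
    × ((m n n' k j : M) → m ∈ w → n ∈ w → IsSucc n' n →
         Rel₂ P m n k → Rel₂ A k m j → Rel₂ P m n' j)

  Finite : M → Set
  Finite t = Σ M λ n → NaturalNumber n × Σ M λ f → IsBijection f n t

  HF : M → Set
  HF z = Σ M λ t → IsTC z t × Finite t

  IsVω : M → Set
  IsVω V = (z : M) → z ∈ V ⟺ HF z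

-- ω is separated from the limit ordinal given by Infinity, and with excluded middle Regularity yields
-- ∈-induction for Δ₀ properties, which serves as induction on ω throughout.  Every other set comes from
-- Axiom Beta: collapsing a well-founded relation on a set sends each point to the set of the images of
-- its predecessors.  On ω × ω, letting ⟨m , n′⟩ (n′ < n) and ⟨m′ , 0⟩ (m′ < m) precede ⟨m , n⟩ makes the
-- collapse compute m + n, so the collapsing function is the graph of addition; a similar relation on
-- (ω × ω) × ω computes m · n + j, and its slice j = 0 is the graph of multiplication.  With + and ·,
-- Ackermann's relation (the v-th binary digit of u is 1) is Δ₀ and well-founded (v < u), and its
-- collapse maps ω onto V_ω: a decoded set is finite with finite transitive closure, and a hereditarily
-- finite set is decoded by ∈-induction, adjoining its elements one at a time through u ↦ 2^v + u.

module Submission where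

open import Defs
open import Data.Nat using (ℕ; suc)
open import Data.Fin using (Fin; zero; suc; #_; lift; _↑ʳ_)
open import Data.Vec using (Vec; lookup; _∷_; [])
open import Data.Product using (Σ; _×_; _,_; proj₁; proj₂)
open import Data.Sum using (_⊎_; inj₁; inj₂)
open import Data.Empty using (⊥; ⊥-elim)
open import Relation.Nullary using (¬_)
open import Relation.Binary.PropositionalEquality using (_≡_; refl; sym; trans; subst; subst₂)
open import Function using (case_of_; _∘_)

private variable
  ℓ ℓ′ : ℕ

⟺-refl : {A : Set} → A ⟺ A
⟺-refl = (λ a → a) , (λ a → a)

⟺-trans : {A B C : Set} → A ⟺ B → B ⟺ C → A ⟺ C
⟺-trans (f , g) (h , k) = (λ a → h (f a)) , (λ c → g (k c))

×-cong : {A B C D : Set} → A ⟺ B → C ⟺ D → (A × C) ⟺ (B × D)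
×-cong (f , g) (h , k) = (λ (a , c) → f a , h c) , (λ (b , d) → g b , k d)

⊎-cong : {A B C D : Set} → A ⟺ B → C ⟺ D → (A ⊎ C) ⟺ (B ⊎ D)
⊎-cong (f , g) (h , k) = (λ { (inj₁ a) → inj₁ (f a) ; (inj₂ c) → inj₂ (h c) }) ,
                         (λ { (inj₁ b) → inj₁ (g b) ; (inj₂ d) → inj₂ (k d) })

→-cong : {A B C D : Set} → A ⟺ B → C ⟺ D → (A → C) ⟺ (B → D)
→-cong (f , g) (h , k) = (λ u b → h (u (g b))) , (λ v a → k (v (f a)))

rename : (Fin ℓ → Fin ℓ′) → Fm ℓ → Fm ℓ′
rename ρ (i ∈̇ j) = ρ i ∈̇ ρ j
rename ρ (i ≐ j) = ρ i ≐ ρ j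
rename ρ ⊥̇ = ⊥̇
rename ρ (φ ⇒̇ ψ) = rename ρ φ ⇒̇ rename ρ ψ
rename ρ (φ ∧̇ ψ) = rename ρ φ ∧̇ rename ρ ψ
rename ρ (φ ∨̇ ψ) = rename ρ φ ∨̇ rename ρ ψ
rename ρ (∀∈ i φ) = ∀∈ (ρ i) (rename (lift 1 ρ) φ)
rename ρ (∃∈ i φ) = ∃∈ (ρ i) (rename (lift 1 ρ) φ)

-- Δ₀ formulas with the notions of Defs as atoms, so that separating by them yields those notions on the
-- nose; translate expands the atoms into Fm.
data Fm⁺ (ℓ : ℕ) : Set where
  _∈⁺_ _≐⁺_ : Fin ℓ → Fin ℓ → Fm⁺ ℓ
  IsOPair⁺ Rel⁺ : Fin ℓ → Fin ℓ → Fin ℓ → Fm⁺ ℓ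
  Rel₂⁺ : Fin ℓ → Fin ℓ → Fin ℓ → Fin ℓ → Fm⁺ ℓ
  Rel₃⁺ : Fin ℓ → Fin ℓ → Fin ℓ → Fin ℓ → Fin ℓ → Fm⁺ ℓ
  IsSucc⁺ : Fin ℓ → Fin ℓ → Fm⁺ ℓ
  NaturalNumber⁺ : Fin ℓ → Fm⁺ ℓ
  ⊥⁺ : Fm⁺ ℓ
  _⇒⁺_ _∧⁺_ _∨⁺_ : Fm⁺ ℓ → Fm⁺ ℓ → Fm⁺ ℓ
  ∀∈⁺ ∃∈⁺ : Fin ℓ → Fm⁺ (suc ℓ) → Fm⁺ ℓ
  ∃⟨,⟩≐⁺ : Fin ℓ → Fm⁺ (suc (suc ℓ)) → Fm⁺ ℓ

infix 6 _∈⁺_ _≐⁺_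
infixr 5 _∧⁺_
infixr 4 _∨⁺_
infixr 3 _⇒⁺_

¬⁺_ : Fm⁺ ℓ → Fm⁺ ℓ
¬⁺ φ = φ ⇒⁺ ⊥⁺

rename⁺ : (Fin ℓ → Fin ℓ′) → Fm⁺ ℓ → Fm⁺ ℓ′
rename⁺ ρ (i ∈⁺ j) = ρ i ∈⁺ ρ j
rename⁺ ρ (i ≐⁺ j) = ρ i ≐⁺ ρ j
rename⁺ ρ (IsOPair⁺ o x y) = IsOPair⁺ (ρ o) (ρ x) (ρ y)
rename⁺ ρ (Rel⁺ r x y) = Rel⁺ (ρ r) (ρ x) (ρ y)
rename⁺ ρ (Rel₂⁺ g x y k) = Rel₂⁺ (ρ g) (ρ x) (ρ y) (ρ k)
rename⁺ ρ (Rel₃⁺ g x y j k) = Rel₃⁺ (ρ g) (ρ x) (ρ y) (ρ j) (ρ k)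
rename⁺ ρ (IsSucc⁺ s x) = IsSucc⁺ (ρ s) (ρ x)
rename⁺ ρ (NaturalNumber⁺ x) = NaturalNumber⁺ (ρ x)
rename⁺ ρ ⊥⁺ = ⊥⁺
rename⁺ ρ (φ ⇒⁺ ψ) = rename⁺ ρ φ ⇒⁺ rename⁺ ρ ψ
rename⁺ ρ (φ ∧⁺ ψ) = rename⁺ ρ φ ∧⁺ rename⁺ ρ ψ
rename⁺ ρ (φ ∨⁺ ψ) = rename⁺ ρ φ ∨⁺ rename⁺ ρ ψ
rename⁺ ρ (∀∈⁺ i φ) = ∀∈⁺ (ρ i) (rename⁺ (lift 1 ρ) φ)
rename⁺ ρ (∃∈⁺ i φ) = ∃∈⁺ (ρ i) (rename⁺ (lift 1 ρ) φ)
rename⁺ ρ (∃⟨,⟩≐⁺ o φ) = ∃⟨,⟩≐⁺ (ρ o) (rename⁺ (lift 2 ρ) φ)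

module Construction (lem : LEM) (S : Structure) (cx : IsCx S) where
  open Structure S
  open IsCx cx

  private variable
    a a′ b b′ ab bc c c′ d e g h h′ i i′ j j′ k k′ kh ku m m′ n n′ : M
    o p q r s s′ t t′ u u′ v x x′ y y′ y₂ ya yb yk z N X Y : M

  ⟦_⟧ₛ : Fm ℓ → Vec M ℓ → Set
  ⟦_⟧ₛ = ⟦_⟧ S

  _∉_ : M → M → Set
  x ∉ y = ¬ (x ∈ y)

  _⊆ₛ_ : M → M → Set
  _⊆ₛ_ = _⊆_ S

  opaque
    stable : {A : Set} → ¬ ¬ A → A
    stable {A} ¬¬a with lem A
    ... | inj₁ a = a
    ... | inj₂ ¬a = ⊥-elim (¬¬a ¬a)

  -- Pairs, ordered pairs, unions and successors

  opaque
    ∅ : M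
    ∅ = proj₁ (Δ₀-separation 0 ⊥̇ [] (proj₁ infinity))

    ∅-empty : Empty S ∅
    ∅-empty z z∈∅ = proj₂ (proj₁ (proj₂ (Δ₀-separation 0 ⊥̇ [] (proj₁ infinity)) z) z∈∅)

  opaque
    empty-unique : Empty S x → Empty S y → x ≡ y
    empty-unique {x} {y} ex ey = extensionality x y λ z → (λ h → ⊥-elim (ex z h)) , (λ h → ⊥-elim (ey z h))

  ≡∅ : Empty S x → x ≡ ∅
  ≡∅ ex = empty-unique ex ∅-empty

  opaque
    pair-∋ˡ : IsPair S p x y → x ∈ p
    pair-∋ˡ {x = x} h = proj₂ (h x) (inj₁ refl)

    pair-∋ʳ : IsPair S p x y → y ∈ p
    pair-∋ʳ {y = y} h = proj₂ (h y) (inj₂ refl)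

    pair-∈ : IsPair S p x y → z ∈ p → z ≡ x ⊎ z ≡ y
    pair-∈ {z = z} h = proj₁ (h z)

    singleton-∈ : IsPair S p x x → z ∈ p → z ≡ x
    singleton-∈ h z∈p with pair-∈ h z∈p
    ... | inj₁ e = e
    ... | inj₂ e = e

    IsPair-unique : IsPair S p x y → IsPair S s x y → p ≡ s
    IsPair-unique {p} {s = s} hp hs =
      extensionality p s λ z → (λ z∈p → proj₂ (hs z) (proj₁ (hp z) z∈p)) , (λ z∈s → proj₂ (hp z) (proj₁ (hs z) z∈s))

  opaque
    opair-∋singleton : IsOPair S o x y → Σ M λ s → IsPair S s x x × s ∈ o
    opair-∋singleton {x = x} h with pair x x
    ... | s , hs = s , hs , proj₂ (h s) (inj₁ hs)

    opair-∋pair : IsOPair S o x y → Σ M λ s → IsPair S s x y × s ∈ o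
    opair-∋pair {x = x} {y} h with pair x y
    ... | s , hs = s , hs , proj₂ (h s) (inj₂ hs)

    opair : (x y : M) → Σ M λ o → IsOPair S o x y
    opair x y with pair x x | pair x y
    ... | s₁ , h₁ | s₂ , h₂ with pair s₁ s₂
    ... | o , ho = o , λ z → (λ z∈o → component (pair-∈ ho z∈o)) ,
                            λ { (inj₁ hz) → proj₂ (ho z) (inj₁ (IsPair-unique hz h₁))
                              ; (inj₂ hz) → proj₂ (ho z) (inj₂ (IsPair-unique hz h₂)) }
      where
      component : z ≡ s₁ ⊎ z ≡ s₂ → IsPair S z x x ⊎ IsPair S z x y
      component (inj₁ refl) = inj₁ h₁
      component (inj₂ refl) = inj₂ h₂

    IsOPair-unique : IsOPair S o x y → IsOPair S s x y → o ≡ s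
    IsOPair-unique {o} {s = s} h h′ =
      extensionality o s λ z → (λ z∈o → proj₂ (h′ z) (proj₁ (h z) z∈o)) , (λ z∈s → proj₂ (h z) (proj₁ (h′ z) z∈s))

    opair-∈∈ : IsOPair S o x y → s ∈ o → z ∈ s → z ≡ x ⊎ z ≡ y
    opair-∈∈ h s∈o z∈s with proj₁ (h _) s∈o
    ... | inj₁ hs = inj₁ (singleton-∈ hs z∈s)
    ... | inj₂ hs = pair-∈ hs z∈s

    opair-∈-∋fst : IsOPair S o x y → s ∈ o → x ∈ s
    opair-∈-∋fst h s∈o with proj₁ (h _) s∈o
    ... | inj₁ hs = pair-∋ˡ hs
    ... | inj₂ hs = pair-∋ˡ hs

    IsOPair-injective : IsOPair S o x y → IsOPair S o x′ y′ → x ≡ x′ × y ≡ y′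
    IsOPair-injective {o} {x} {y} {x′} {y′} h h′ = x≡x′ , y≡y′
      where
      x≡x′ : x ≡ x′
      x≡x′ with opair-∋singleton h′
      ... | s , hs , s∈o = singleton-∈ hs (opair-∈-∋fst h s∈o)
      -- Either y′ = y, or y′ = x and then y ∈ {x , y} ∈ o gives y = y′ or y = x′ = x = y′.
      y≡y′ : y ≡ y′
      y≡y′ with opair-∋pair h′
      ... | s , hs , s∈o with opair-∈∈ h s∈o (pair-∋ʳ hs)
      ... | inj₂ e = sym e
      ... | inj₁ e with opair-∋pair h
      ... | s′ , hs′ , s′∈o with opair-∈∈ h′ s′∈o (pair-∋ʳ hs′)
      ... | inj₂ e′ = e′
      ... | inj₁ e′ = trans e′ (trans (sym x≡x′) (sym e))

  opaque
    ∈-irrefl : x ∉ x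
    ∈-irrefl {x} x∈x with pair x x
    ... | s , hs with regularity s (λ e → e x (pair-∋ˡ hs))
    ... | y , y∈s , ymin with singleton-∈ hs y∈s
    ... | refl = ymin y x∈x y∈s

    ∈-asym : x ∈ y → y ∉ x
    ∈-asym {x} {y} x∈y y∈x with pair x y
    ... | s , hs with regularity s (λ e → e x (pair-∋ˡ hs))
    ... | z , z∈s , zmin with pair-∈ hs z∈s
    ... | inj₁ refl = zmin y y∈x (pair-∋ʳ hs)
    ... | inj₂ refl = zmin x x∈y (pair-∋ˡ hs)

  IsBinaryUnion : M → M → M → Set
  IsBinaryUnion u x y = (z : M) → z ∈ u ⟺ (z ∈ x ⊎ z ∈ y)

  opaque
    binaryUnion : (x y : M) → Σ M λ u → IsBinaryUnion u x y
    binaryUnion x y with pair x y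
    ... | p , hp with union p
    ... | u , hu = u , λ z → (λ z∈u → split (proj₁ (hu z) z∈u)) , collect z
      where
      split : Σ M (λ v → v ∈ p × z ∈ v) → z ∈ x ⊎ z ∈ y
      split (v , v∈p , z∈v) with pair-∈ hp v∈p
      ... | inj₁ refl = inj₁ z∈v
      ... | inj₂ refl = inj₂ z∈v
      collect : (z : M) → z ∈ x ⊎ z ∈ y → z ∈ u
      collect z (inj₁ z∈x) = proj₂ (hu z) (x , pair-∋ˡ hp , z∈x)
      collect z (inj₂ z∈y) = proj₂ (hu z) (y , pair-∋ʳ hp , z∈y)

  opaque
    successor : (x : M) → Σ M λ s → IsSucc S s x
    successor x with pair x x
    ... | sx , hsx with binaryUnion x sx
    ... | u , hu = u , λ z → (λ z∈u → fromUnion (proj₁ (hu z) z∈u)) ,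
                            λ { (inj₁ z∈x) → proj₂ (hu z) (inj₁ z∈x)
                              ; (inj₂ refl) → proj₂ (hu z) (inj₂ (pair-∋ˡ hsx)) }
      where
      fromUnion : z ∈ x ⊎ z ∈ sx → z ∈ x ⊎ z ≡ x
      fromUnion (inj₁ z∈x) = inj₁ z∈x
      fromUnion (inj₂ z∈sx) = inj₂ (singleton-∈ hsx z∈sx)

  opaque
    succ-∋ : IsSucc S s x → x ∈ s
    succ-∋ {x = x} h = proj₂ (h x) (inj₂ refl)

    succ-⊇ : IsSucc S s x → z ∈ x → z ∈ s
    succ-⊇ {z = z} h z∈x = proj₂ (h z) (inj₁ z∈x)

    IsSucc-unique : IsSucc S s x → IsSucc S t x → s ≡ t
    IsSucc-unique {s} {t = t} hs ht =
      extensionality s t λ z → (λ z∈s → proj₂ (ht z) (proj₁ (hs z) z∈s)) , (λ z∈t → proj₂ (hs z) (proj₁ (ht z) z∈t))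

  -- Δ₀ definability

  lift-lookup₁ : {ρ : Fin ℓ → Fin ℓ′} {γ : Vec M ℓ} {δ : Vec M ℓ′} → ((i : Fin ℓ) → lookup δ (ρ i) ≡ lookup γ i) →
                 (z : M) (k : Fin (suc ℓ)) → lookup (z ∷ δ) (lift 1 ρ k) ≡ lookup (z ∷ γ) k
  lift-lookup₁ e z zero = refl
  lift-lookup₁ e z (suc k) = e k

  opaque
    rename-sound : (ρ : Fin ℓ → Fin ℓ′) (φ : Fm ℓ) (γ : Vec M ℓ) (δ : Vec M ℓ′) →
                   ((i : Fin ℓ) → lookup δ (ρ i) ≡ lookup γ i) → ⟦ rename ρ φ ⟧ₛ δ ⟺ ⟦ φ ⟧ₛ γ
    rename-sound ρ (i ∈̇ j) γ δ e rewrite e i | e j = ⟺-refl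
    rename-sound ρ (i ≐ j) γ δ e rewrite e i | e j = ⟺-refl
    rename-sound ρ ⊥̇ γ δ e = ⟺-refl
    rename-sound ρ (φ ⇒̇ ψ) γ δ e = →-cong (rename-sound ρ φ γ δ e) (rename-sound ρ ψ γ δ e)
    rename-sound ρ (φ ∧̇ ψ) γ δ e = ×-cong (rename-sound ρ φ γ δ e) (rename-sound ρ ψ γ δ e)
    rename-sound ρ (φ ∨̇ ψ) γ δ e = ⊎-cong (rename-sound ρ φ γ δ e) (rename-sound ρ ψ γ δ e)
    rename-sound ρ (∀∈ i φ) γ δ e rewrite e i =
      (λ h z z∈ → proj₁ (rename-sound (lift 1 ρ) φ (z ∷ γ) (z ∷ δ) (lift-lookup₁ e z)) (h z z∈)) ,
      (λ h z z∈ → proj₂ (rename-sound (lift 1 ρ) φ (z ∷ γ) (z ∷ δ) (lift-lookup₁ e z)) (h z z∈))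
    rename-sound ρ (∃∈ i φ) γ δ e rewrite e i =
      (λ (z , z∈ , h) → z , z∈ , proj₁ (rename-sound (lift 1 ρ) φ (z ∷ γ) (z ∷ δ) (lift-lookup₁ e z)) h) ,
      (λ (z , z∈ , h) → z , z∈ , proj₂ (rename-sound (lift 1 ρ) φ (z ∷ γ) (z ∷ δ) (lift-lookup₁ e z)) h)

  pairF : Fin ℓ → Fin ℓ → Fin ℓ → Fm ℓ
  pairF p x y = ∀∈ p ((zero ≐ suc x) ∨̇ (zero ≐ suc y)) ∧̇ ((x ∈̇ p) ∧̇ (y ∈̇ p))

  opaque
    pairF-sound : (p x y : Fin ℓ) (ρ : Vec M ℓ) →
                  ⟦ pairF p x y ⟧ₛ ρ ⟺ IsPair S (lookup ρ p) (lookup ρ x) (lookup ρ y)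
    pairF-sound p x y ρ =
      (λ (h , x∈p , y∈p) z → h z , λ { (inj₁ refl) → x∈p ; (inj₂ refl) → y∈p }) ,
      (λ h → (λ z z∈p → proj₁ (h z) z∈p) , pair-∋ˡ h , pair-∋ʳ h)

  opairF : Fin ℓ → Fin ℓ → Fin ℓ → Fm ℓ
  opairF o x y = ∀∈ o (pairF zero (suc x) (suc x) ∨̇ pairF zero (suc x) (suc y)) ∧̇
                 (∃∈ o (pairF zero (suc x) (suc x)) ∧̇ ∃∈ o (pairF zero (suc x) (suc y)))

  opaque
    opairF-sound : (o x y : Fin ℓ) (ρ : Vec M ℓ) →
                   ⟦ opairF o x y ⟧ₛ ρ ⟺ IsOPair S (lookup ρ o) (lookup ρ x) (lookup ρ y)
    opairF-sound o x y ρ = to , from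
      where
      sing : (z : M) → ⟦ pairF zero (suc x) (suc x) ⟧ₛ (z ∷ ρ) ⟺ IsPair S z (lookup ρ x) (lookup ρ x)
      sing z = pairF-sound zero (suc x) (suc x) (z ∷ ρ)
      dbl : (z : M) → ⟦ pairF zero (suc x) (suc y) ⟧ₛ (z ∷ ρ) ⟺ IsPair S z (lookup ρ x) (lookup ρ y)
      dbl z = pairF-sound zero (suc x) (suc y) (z ∷ ρ)
      to : ⟦ opairF o x y ⟧ₛ ρ → IsOPair S (lookup ρ o) (lookup ρ x) (lookup ρ y)
      to (h , (s₁ , s₁∈o , h₁) , (s₂ , s₂∈o , h₂)) z =
        proj₁ (⊎-cong (sing z) (dbl z)) ∘ h z ,
        λ { (inj₁ hz) → subst (_∈ lookup ρ o) (IsPair-unique (proj₁ (sing s₁) h₁) hz) s₁∈o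
          ; (inj₂ hz) → subst (_∈ lookup ρ o) (IsPair-unique (proj₁ (dbl s₂) h₂) hz) s₂∈o }
      from : IsOPair S (lookup ρ o) (lookup ρ x) (lookup ρ y) → ⟦ opairF o x y ⟧ₛ ρ
      from h = (λ z z∈o → proj₂ (⊎-cong (sing z) (dbl z)) (proj₁ (h z) z∈o)) ,
               (let (s , hs , s∈o) = opair-∋singleton h in s , s∈o , proj₂ (sing s) hs) ,
               (let (s , hs , s∈o) = opair-∋pair h in s , s∈o , proj₂ (dbl s) hs)

  relF : Fin ℓ → Fin ℓ → Fin ℓ → Fm ℓ
  relF r x y = ∃∈ r (opairF zero (suc x) (suc y))

  opaque
    relF-sound : (r x y : Fin ℓ) (ρ : Vec M ℓ) →
                 ⟦ relF r x y ⟧ₛ ρ ⟺ Rel S (lookup ρ r) (lookup ρ x) (lookup ρ y)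
    relF-sound r x y ρ =
      (λ (z , z∈r , h) → z , proj₁ (opairF-sound zero (suc x) (suc y) (z ∷ ρ)) h , z∈r) ,
      (λ (z , h , z∈r) → z , z∈r , proj₂ (opairF-sound zero (suc x) (suc y) (z ∷ ρ)) h)

  rel₂F : Fin ℓ → Fin ℓ → Fin ℓ → Fin ℓ → Fm ℓ
  rel₂F g x y k = ∃∈ g (∃∈ zero (∃∈ zero (opairF zero (3 ↑ʳ x) (3 ↑ʳ y) ∧̇ opairF (# 2) zero (3 ↑ʳ k))))

  opaque
    rel₂F-sound : (g x y k : Fin ℓ) (ρ : Vec M ℓ) →
                  ⟦ rel₂F g x y k ⟧ₛ ρ ⟺ Rel₂ S (lookup ρ g) (lookup ρ x) (lookup ρ y) (lookup ρ k)
    rel₂F-sound g x y k ρ =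
      (λ (q , q∈g , s , s∈q , p , p∈s , hp , hq) →
        p , proj₁ (inner p s q) hp , q , proj₁ (outer p s q) hq , q∈g) ,
      (λ (p , hp , q , hq , q∈g) →
        let (s , hs , s∈q) = opair-∋singleton hq in
        q , q∈g , s , s∈q , p , pair-∋ˡ hs , proj₂ (inner p s q) hp , proj₂ (outer p s q) hq)
      where
      inner : (p s q : M) → ⟦ opairF zero (3 ↑ʳ x) (3 ↑ʳ y) ⟧ₛ (p ∷ s ∷ q ∷ ρ) ⟺ IsOPair S p (lookup ρ x) (lookup ρ y)
      inner p s q = opairF-sound zero (3 ↑ʳ x) (3 ↑ʳ y) (p ∷ s ∷ q ∷ ρ)
      outer : (p s q : M) → ⟦ opairF (# 2) zero (3 ↑ʳ k) ⟧ₛ (p ∷ s ∷ q ∷ ρ) ⟺ IsOPair S q p (lookup ρ k)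
      outer p s q = opairF-sound (# 2) zero (3 ↑ʳ k) (p ∷ s ∷ q ∷ ρ)

  succF : Fin ℓ → Fin ℓ → Fm ℓ
  succF s x = ∀∈ s ((zero ∈̇ suc x) ∨̇ (zero ≐ suc x)) ∧̇ (∀∈ x (zero ∈̇ suc s) ∧̇ (x ∈̇ s))

  opaque
    succF-sound : (s x : Fin ℓ) (ρ : Vec M ℓ) → ⟦ succF s x ⟧ₛ ρ ⟺ IsSucc S (lookup ρ s) (lookup ρ x)
    succF-sound s x ρ =
      (λ (h₁ , h₂ , h₃) z → h₁ z , λ { (inj₁ z∈x) → h₂ z z∈x ; (inj₂ refl) → h₃ }) ,
      (λ h → (λ z z∈s → proj₁ (h z) z∈s) , (λ z → succ-⊇ h) , succ-∋ h)

  transitiveF : Fin ℓ → Fm ℓ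
  transitiveF t = ∀∈ t (∀∈ zero (zero ∈̇ suc (suc t)))

  ordinalF : Fin ℓ → Fm ℓ
  ordinalF x = transitiveF x ∧̇ ∀∈ x (transitiveF zero)

  -- The quantifier in ∃ b. IsSucc x b is bounded by x, since b ∈ x.
  zeroOrSuccF : Fin ℓ → Fm ℓ
  zeroOrSuccF x = ∀∈ x ⊥̇ ∨̇ ∃∈ x (succF (suc x) zero)

  opaque
    zeroOrSuccF-sound : (x : Fin ℓ) (ρ : Vec M ℓ) →
                        ⟦ zeroOrSuccF x ⟧ₛ ρ ⟺ (Empty S (lookup ρ x) ⊎ Σ M λ b → IsSucc S (lookup ρ x) b)
    zeroOrSuccF-sound x ρ =
      (λ { (inj₁ e) → inj₁ e ; (inj₂ (b , _ , h)) → inj₂ (b , proj₁ (succF-sound (suc x) zero (b ∷ ρ)) h) }) ,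
      (λ { (inj₁ e) → inj₁ e ; (inj₂ (b , h)) → inj₂ (b , succ-∋ h , proj₂ (succF-sound (suc x) zero (b ∷ ρ)) h) })

  naturalNumberF : Fin ℓ → Fm ℓ
  naturalNumberF x = ordinalF x ∧̇ (∀∈ x (zeroOrSuccF zero) ∧̇ zeroOrSuccF x)

  opaque
    naturalNumberF-sound : (x : Fin ℓ) (ρ : Vec M ℓ) → ⟦ naturalNumberF x ⟧ₛ ρ ⟺ NaturalNumber S (lookup ρ x)
    naturalNumberF-sound x ρ =
      (λ (ord , below , here) → ord , λ
        { y (inj₁ y∈x) → proj₁ (zeroOrSuccF-sound zero (y ∷ ρ)) (below y y∈x)
        ; y (inj₂ refl) → proj₁ (zeroOrSuccF-sound x ρ) here }) ,
      (λ (ord , h) → ord , (λ y y∈x → proj₂ (zeroOrSuccF-sound zero (y ∷ ρ)) (h y (inj₁ y∈x))) ,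
                           proj₂ (zeroOrSuccF-sound x ρ) (h (lookup ρ x) (inj₂ refl)))

  -- ∃ s ∈ o. ∃ s′ ∈ o. ∃ x ∈ s. ∃ y ∈ s′. o = ⟨x , y⟩ ∧ ψ(x , y)
  splitF : Fin ℓ → Fm (suc (suc ℓ)) → Fm ℓ
  splitF o ψ = ∃∈ o (∃∈ (suc o) (∃∈ (# 1) (∃∈ (# 1) (opairF (4 ↑ʳ o) (# 1) (# 0) ∧̇ rename (lift 2 (2 ↑ʳ_)) ψ))))

  opaque
    splitF-sound : (o : Fin ℓ) (ψ : Fm (suc (suc ℓ))) (ρ : Vec M ℓ) →
                   ⟦ splitF o ψ ⟧ₛ ρ ⟺ Σ M λ x → Σ M λ y → IsOPair S (lookup ρ o) x y × ⟦ ψ ⟧ₛ (y ∷ x ∷ ρ)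
    splitF-sound o ψ ρ =
      (λ (s , s∈o , s′ , s′∈o , x , x∈s , y , y∈s′ , hxy , hψ) →
        x , y , proj₁ (pairing s s′ x y) hxy , proj₁ (weakening s s′ x y) hψ) ,
      (λ (x , y , hxy , hψ) →
        let (s , hs , s∈o) = opair-∋singleton hxy
            (s′ , hs′ , s′∈o) = opair-∋pair hxy
        in s , s∈o , s′ , s′∈o , x , pair-∋ˡ hs , y , pair-∋ʳ hs′ ,
           proj₂ (pairing s s′ x y) hxy , proj₂ (weakening s s′ x y) hψ)
      where
      pairing : (s s′ x y : M) → ⟦ opairF (4 ↑ʳ o) (# 1) (# 0) ⟧ₛ (y ∷ x ∷ s′ ∷ s ∷ ρ) ⟺ IsOPair S (lookup ρ o) x y
      pairing s s′ x y = opairF-sound (4 ↑ʳ o) (# 1) (# 0) (y ∷ x ∷ s′ ∷ s ∷ ρ)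
      weakening : (s s′ x y : M) → ⟦ rename (lift 2 (2 ↑ʳ_)) ψ ⟧ₛ (y ∷ x ∷ s′ ∷ s ∷ ρ) ⟺ ⟦ ψ ⟧ₛ (y ∷ x ∷ ρ)
      weakening s s′ x y = rename-sound (lift 2 (2 ↑ʳ_)) ψ (y ∷ x ∷ ρ) (y ∷ x ∷ s′ ∷ s ∷ ρ) λ
        { zero → refl ; (suc zero) → refl ; (suc (suc i)) → refl }

  Rel₃ : M → M → M → M → M → Set
  Rel₃ g x y j k = Σ M λ a → IsOPair S a x y × Rel₂ S g a j k

  rel₃F : Fin ℓ → Fin ℓ → Fin ℓ → Fin ℓ → Fin ℓ → Fm ℓ
  rel₃F g x y j k = ∃∈ g (splitF zero (splitF (# 1)
    (opairF (# 1) (5 ↑ʳ x) (5 ↑ʳ y) ∧̇ ((zero ≐ (5 ↑ʳ j)) ∧̇ ((# 2) ≐ (5 ↑ʳ k))))))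

  opaque
    rel₃F-sound : (g x y j k : Fin ℓ) (ρ : Vec M ℓ) →
                  ⟦ rel₃F g x y j k ⟧ₛ ρ ⟺ Rel₃ (lookup ρ g) (lookup ρ x) (lookup ρ y) (lookup ρ j) (lookup ρ k)
    rel₃F-sound {ℓ} g x y j k ρ =
      (λ (q , q∈g , h) →
        let (p , k′ , hq , h′) = proj₁ (splitF-sound zero body₁ (q ∷ ρ)) h
            (a , j′ , hp , ha , j′≡j , k′≡k) = proj₁ (splitF-sound (# 1) body₂ (k′ ∷ p ∷ q ∷ ρ)) h′
        in a , proj₁ (inner a j′ k′ p q) ha , p , subst (IsOPair S p a) j′≡j hp ,
           q , subst (IsOPair S q p) k′≡k hq , q∈g) ,
      (λ (a , ha , p , hp , q , hq , q∈g) →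
        q , q∈g , proj₂ (splitF-sound zero body₁ (q ∷ ρ))
          (p , lookup ρ k , hq , proj₂ (splitF-sound (# 1) body₂ (lookup ρ k ∷ p ∷ q ∷ ρ))
            (a , lookup ρ j , hp , proj₂ (inner a (lookup ρ j) (lookup ρ k) p q) ha , refl , refl)))
      where
      body₂ : Fm (suc (suc (suc (suc (suc ℓ)))))
      body₂ = opairF (# 1) (5 ↑ʳ x) (5 ↑ʳ y) ∧̇ ((zero ≐ (5 ↑ʳ j)) ∧̇ ((# 2) ≐ (5 ↑ʳ k)))
      body₁ : Fm (suc (suc (suc ℓ)))
      body₁ = splitF (# 1) body₂
      inner : (a j′ k′ p q : M) →
              ⟦ opairF (# 1) (5 ↑ʳ x) (5 ↑ʳ y) ⟧ₛ (j′ ∷ a ∷ k′ ∷ p ∷ q ∷ ρ) ⟺ IsOPair S a (lookup ρ x) (lookup ρ y)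
      inner a j′ k′ p q = opairF-sound (# 1) (5 ↑ʳ x) (5 ↑ʳ y) (j′ ∷ a ∷ k′ ∷ p ∷ q ∷ ρ)

  ⟦_⟧⁺ : Fm⁺ ℓ → Vec M ℓ → Set
  ⟦ i ∈⁺ j ⟧⁺ ρ = lookup ρ i ∈ lookup ρ j
  ⟦ i ≐⁺ j ⟧⁺ ρ = lookup ρ i ≡ lookup ρ j
  ⟦ IsOPair⁺ o x y ⟧⁺ ρ = IsOPair S (lookup ρ o) (lookup ρ x) (lookup ρ y)
  ⟦ Rel⁺ r x y ⟧⁺ ρ = Rel S (lookup ρ r) (lookup ρ x) (lookup ρ y)
  ⟦ Rel₂⁺ g x y k ⟧⁺ ρ = Rel₂ S (lookup ρ g) (lookup ρ x) (lookup ρ y) (lookup ρ k)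
  ⟦ Rel₃⁺ g x y j k ⟧⁺ ρ = Rel₃ (lookup ρ g) (lookup ρ x) (lookup ρ y) (lookup ρ j) (lookup ρ k)
  ⟦ IsSucc⁺ s x ⟧⁺ ρ = IsSucc S (lookup ρ s) (lookup ρ x)
  ⟦ NaturalNumber⁺ x ⟧⁺ ρ = NaturalNumber S (lookup ρ x)
  ⟦ ⊥⁺ ⟧⁺ ρ = ⊥
  ⟦ φ ⇒⁺ ψ ⟧⁺ ρ = ⟦ φ ⟧⁺ ρ → ⟦ ψ ⟧⁺ ρ
  ⟦ φ ∧⁺ ψ ⟧⁺ ρ = ⟦ φ ⟧⁺ ρ × ⟦ ψ ⟧⁺ ρ
  ⟦ φ ∨⁺ ψ ⟧⁺ ρ = ⟦ φ ⟧⁺ ρ ⊎ ⟦ ψ ⟧⁺ ρ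
  ⟦ ∀∈⁺ i φ ⟧⁺ ρ = (z : M) → z ∈ lookup ρ i → ⟦ φ ⟧⁺ (z ∷ ρ)
  ⟦ ∃∈⁺ i φ ⟧⁺ ρ = Σ M λ z → z ∈ lookup ρ i × ⟦ φ ⟧⁺ (z ∷ ρ)
  ⟦ ∃⟨,⟩≐⁺ o φ ⟧⁺ ρ = Σ M λ x → Σ M λ y → IsOPair S (lookup ρ o) x y × ⟦ φ ⟧⁺ (y ∷ x ∷ ρ)

  opaque
    rename⁺-sound : (ρ : Fin ℓ → Fin ℓ′) (φ : Fm⁺ ℓ) (γ : Vec M ℓ) (δ : Vec M ℓ′) →
                    ((i : Fin ℓ) → lookup δ (ρ i) ≡ lookup γ i) → ⟦ rename⁺ ρ φ ⟧⁺ δ ⟺ ⟦ φ ⟧⁺ γ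
    rename⁺-sound ρ (i ∈⁺ j) γ δ e rewrite e i | e j = ⟺-refl
    rename⁺-sound ρ (i ≐⁺ j) γ δ e rewrite e i | e j = ⟺-refl
    rename⁺-sound ρ (IsOPair⁺ o x y) γ δ e rewrite e o | e x | e y = ⟺-refl
    rename⁺-sound ρ (Rel⁺ r x y) γ δ e rewrite e r | e x | e y = ⟺-refl
    rename⁺-sound ρ (Rel₂⁺ g x y k) γ δ e rewrite e g | e x | e y | e k = ⟺-refl
    rename⁺-sound ρ (Rel₃⁺ g x y j k) γ δ e rewrite e g | e x | e y | e j | e k = ⟺-refl
    rename⁺-sound ρ (IsSucc⁺ s x) γ δ e rewrite e s | e x = ⟺-refl
    rename⁺-sound ρ (NaturalNumber⁺ x) γ δ e rewrite e x = ⟺-refl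
    rename⁺-sound ρ ⊥⁺ γ δ e = ⟺-refl
    rename⁺-sound ρ (φ ⇒⁺ ψ) γ δ e = →-cong (rename⁺-sound ρ φ γ δ e) (rename⁺-sound ρ ψ γ δ e)
    rename⁺-sound ρ (φ ∧⁺ ψ) γ δ e = ×-cong (rename⁺-sound ρ φ γ δ e) (rename⁺-sound ρ ψ γ δ e)
    rename⁺-sound ρ (φ ∨⁺ ψ) γ δ e = ⊎-cong (rename⁺-sound ρ φ γ δ e) (rename⁺-sound ρ ψ γ δ e)
    rename⁺-sound ρ (∀∈⁺ i φ) γ δ e rewrite e i =
      (λ h z z∈ → proj₁ (rename⁺-sound (lift 1 ρ) φ (z ∷ γ) (z ∷ δ) (lift-lookup₁ e z)) (h z z∈)) ,
      (λ h z z∈ → proj₂ (rename⁺-sound (lift 1 ρ) φ (z ∷ γ) (z ∷ δ) (lift-lookup₁ e z)) (h z z∈))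
    rename⁺-sound ρ (∃∈⁺ i φ) γ δ e rewrite e i =
      (λ (z , z∈ , h) → z , z∈ , proj₁ (rename⁺-sound (lift 1 ρ) φ (z ∷ γ) (z ∷ δ) (lift-lookup₁ e z)) h) ,
      (λ (z , z∈ , h) → z , z∈ , proj₂ (rename⁺-sound (lift 1 ρ) φ (z ∷ γ) (z ∷ δ) (lift-lookup₁ e z)) h)
    rename⁺-sound ρ (∃⟨,⟩≐⁺ o φ) γ δ e rewrite e o =
      (λ (x , y , h , hφ) → x , y , h , proj₁ (rename⁺-sound (lift 2 ρ) φ (y ∷ x ∷ γ) (y ∷ x ∷ δ) (lift-lookup₂ x y)) hφ) ,
      (λ (x , y , h , hφ) → x , y , h , proj₂ (rename⁺-sound (lift 2 ρ) φ (y ∷ x ∷ γ) (y ∷ x ∷ δ) (lift-lookup₂ x y)) hφ)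
      where
      lift-lookup₂ : (x y : M) (k : Fin (suc (suc _))) → lookup (y ∷ x ∷ δ) (lift 2 ρ k) ≡ lookup (y ∷ x ∷ γ) k
      lift-lookup₂ x y zero = refl
      lift-lookup₂ x y (suc zero) = refl
      lift-lookup₂ x y (suc (suc k)) = e k

  translate : Fm⁺ ℓ → Fm ℓ
  translate (i ∈⁺ j) = i ∈̇ j
  translate (i ≐⁺ j) = i ≐ j
  translate (IsOPair⁺ o x y) = opairF o x y
  translate (Rel⁺ r x y) = relF r x y
  translate (Rel₂⁺ g x y k) = rel₂F g x y k
  translate (Rel₃⁺ g x y j k) = rel₃F g x y j k
  translate (IsSucc⁺ s x) = succF s x
  translate (NaturalNumber⁺ x) = naturalNumberF x
  translate ⊥⁺ = ⊥̇
  translate (φ ⇒⁺ ψ) = translate φ ⇒̇ translate ψ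
  translate (φ ∧⁺ ψ) = translate φ ∧̇ translate ψ
  translate (φ ∨⁺ ψ) = translate φ ∨̇ translate ψ
  translate (∀∈⁺ i φ) = ∀∈ i (translate φ)
  translate (∃∈⁺ i φ) = ∃∈ i (translate φ)
  translate (∃⟨,⟩≐⁺ o φ) = splitF o (translate φ)

  opaque
    translate-sound : (φ : Fm⁺ ℓ) (ρ : Vec M ℓ) → ⟦ translate φ ⟧ₛ ρ ⟺ ⟦ φ ⟧⁺ ρ
    translate-sound (i ∈⁺ j) ρ = ⟺-refl
    translate-sound (i ≐⁺ j) ρ = ⟺-refl
    translate-sound (IsOPair⁺ o x y) ρ = opairF-sound o x y ρ
    translate-sound (Rel⁺ r x y) ρ = relF-sound r x y ρ
    translate-sound (Rel₂⁺ g x y k) ρ = rel₂F-sound g x y k ρ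
    translate-sound (Rel₃⁺ g x y j k) ρ = rel₃F-sound g x y j k ρ
    translate-sound (IsSucc⁺ s x) ρ = succF-sound s x ρ
    translate-sound (NaturalNumber⁺ x) ρ = naturalNumberF-sound x ρ
    translate-sound ⊥⁺ ρ = ⟺-refl
    translate-sound (φ ⇒⁺ ψ) ρ = →-cong (translate-sound φ ρ) (translate-sound ψ ρ)
    translate-sound (φ ∧⁺ ψ) ρ = ×-cong (translate-sound φ ρ) (translate-sound ψ ρ)
    translate-sound (φ ∨⁺ ψ) ρ = ⊎-cong (translate-sound φ ρ) (translate-sound ψ ρ)
    translate-sound (∀∈⁺ i φ) ρ =
      (λ h z z∈ → proj₁ (translate-sound φ (z ∷ ρ)) (h z z∈)) ,
      (λ h z z∈ → proj₂ (translate-sound φ (z ∷ ρ)) (h z z∈))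
    translate-sound (∃∈⁺ i φ) ρ =
      (λ (z , z∈ , h) → z , z∈ , proj₁ (translate-sound φ (z ∷ ρ)) h) ,
      (λ (z , z∈ , h) → z , z∈ , proj₂ (translate-sound φ (z ∷ ρ)) h)
    translate-sound (∃⟨,⟩≐⁺ o φ) ρ = ⟺-trans (splitF-sound o (translate φ) ρ)
      ((λ (x , y , hxy , h) → x , y , hxy , proj₁ (translate-sound φ (y ∷ x ∷ ρ)) h) ,
       (λ (x , y , hxy , h) → x , y , hxy , proj₂ (translate-sound φ (y ∷ x ∷ ρ)) h))

  Separable : M → (M → Set) → Set
  Separable a P = Σ M λ b → (z : M) → z ∈ b ⟺ (z ∈ a × P z)

  opaque
    separation : (φ : Fm⁺ (suc ℓ)) (ρ : Vec M ℓ) (a : M) → Separable a (λ z → ⟦ φ ⟧⁺ (z ∷ ρ))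
    separation {ℓ} φ ρ a with Δ₀-separation ℓ (translate φ) ρ a
    ... | b , hb = b , λ z →
      (λ z∈b → let (z∈a , h) = proj₁ (hb z) z∈b in z∈a , proj₁ (translate-sound φ (z ∷ ρ)) h) ,
      (λ (z∈a , h) → proj₂ (hb z) (z∈a , proj₂ (translate-sound φ (z ∷ ρ)) h))

    Separable-cong : {P Q : M → Set} → ((z : M) → z ∈ a → P z ⟺ Q z) → Separable a P → Separable a Q
    Separable-cong eq (b , hb) = b , λ z →
      (λ z∈b → let (z∈a , pz) = proj₁ (hb z) z∈b in z∈a , proj₁ (eq z z∈a) pz) ,
      (λ (z∈a , qz) → proj₂ (hb z) (z∈a , proj₂ (eq z z∈a) qz))

    Separable-¬ : {P : M → Set} → Separable a P → Separable a (λ z → ¬ P z)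
    Separable-¬ {a} (b , hb) = Separable-cong
      (λ z z∈a → (λ z∉b pz → z∉b (proj₂ (hb z) (z∈a , pz))) , (λ ¬pz z∈b → ¬pz (proj₂ (proj₁ (hb z) z∈b))))
      (separation (¬⁺ (# 0 ∈⁺ # 1)) (b ∷ []) a)

  -- Minimal elements and ∈-induction

  opaque
    ∈-minimal : {P : M → Set} → Separable a P → Σ M (λ z → z ∈ a × P z) →
                Σ M λ z → z ∈ a × P z × ((y : M) → y ∈ z → y ∈ a → ¬ P y)
    ∈-minimal (b , hb) (z , z∈a , pz) with regularity b (λ e → e z (proj₂ (hb z) (z∈a , pz)))
    ... | m , m∈b , mmin = m , proj₁ (proj₁ (hb m) m∈b) , proj₂ (proj₁ (hb m) m∈b) ,
                          λ y y∈m y∈a py → mmin y y∈m (proj₂ (hb y) (y∈a , py))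

    ∈-induction : {P : M → Set} → Separable a P →
                  ((z : M) → z ∈ a → ((y : M) → y ∈ z → y ∈ a → P y) → P z) → (z : M) → z ∈ a → P z
    ∈-induction sp step z z∈a = stable λ ¬pz →
      let (m , m∈a , ¬pm , mmin) = ∈-minimal (Separable-¬ sp) (z , z∈a , ¬pz)
      in ¬pm (step m m∈a λ y y∈m y∈a → stable (mmin y y∈m y∈a))

  -- Ordinals and ω

  Comparable : M → M → Set
  Comparable x y = x ∈ y ⊎ x ≡ y ⊎ y ∈ x

  opaque
    Ordinal-∈ : Ordinal S a → y ∈ a → Ordinal S y
    Ordinal-∈ {y = y} (tr , elems) y∈a = elems y y∈a , λ z z∈y → elems z (tr y y∈a z z∈y)

    -- A ∈-minimal incomparable pair (δ₀, ε₀) would have the same elements.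
    ordinal-trichotomy : {γ δ ε : M} → Ordinal S γ → δ ∈ γ → ε ∈ γ → Comparable δ ε
    ordinal-trichotomy {γ} {δ} {ε} (tr , elems) δ∈γ ε∈γ = stable λ ¬cmp →
      let (δ₀ , δ₀∈γ , (ε₁ , ε₁∈γ , ¬c₁) , δ₀min) =
            ∈-minimal (separation (∃∈⁺ (# 1) (¬⁺ (# 1 ∈⁺ # 0 ∨⁺ # 1 ≐⁺ # 0 ∨⁺ # 0 ∈⁺ # 1))) (γ ∷ []) γ)
                      (δ , δ∈γ , ε , ε∈γ , ¬cmp)
          (ε₀ , ε₀∈γ , ¬c₀ , ε₀min) =
            ∈-minimal (separation (¬⁺ (# 1 ∈⁺ # 0 ∨⁺ # 1 ≐⁺ # 0 ∨⁺ # 0 ∈⁺ # 1)) (δ₀ ∷ []) γ)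
                      (ε₁ , ε₁∈γ , ¬c₁)
      in ¬c₀ (inj₂ (inj₁ (extensionality δ₀ ε₀ λ x →
           (λ x∈δ₀ → ⊆ε₀ δ₀∈γ ¬c₀ x∈δ₀ (stable λ ¬c → δ₀min x x∈δ₀ (tr δ₀ δ₀∈γ x x∈δ₀) (ε₀ , ε₀∈γ , ¬c))) ,
           (λ x∈ε₀ → ⊆δ₀ ε₀∈γ ¬c₀ x∈ε₀ (stable λ ¬c → ε₀min x x∈ε₀ (tr ε₀ ε₀∈γ x x∈ε₀) ¬c)))))
      where
      ⊆ε₀ : {δ₀ ε₀ x : M} → δ₀ ∈ γ → ¬ Comparable δ₀ ε₀ → x ∈ δ₀ → Comparable x ε₀ → x ∈ ε₀
      ⊆ε₀ δ₀∈γ ¬c₀ x∈δ₀ (inj₁ x∈ε₀) = x∈ε₀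
      ⊆ε₀ δ₀∈γ ¬c₀ x∈δ₀ (inj₂ (inj₁ refl)) = ⊥-elim (¬c₀ (inj₂ (inj₂ x∈δ₀)))
      ⊆ε₀ δ₀∈γ ¬c₀ x∈δ₀ (inj₂ (inj₂ ε₀∈x)) = ⊥-elim (¬c₀ (inj₂ (inj₂ (elems _ δ₀∈γ _ x∈δ₀ _ ε₀∈x))))
      ⊆δ₀ : {δ₀ ε₀ x : M} → ε₀ ∈ γ → ¬ Comparable δ₀ ε₀ → x ∈ ε₀ → Comparable δ₀ x → x ∈ δ₀
      ⊆δ₀ ε₀∈γ ¬c₀ x∈ε₀ (inj₁ δ₀∈x) = ⊥-elim (¬c₀ (inj₁ (elems _ ε₀∈γ _ x∈ε₀ _ δ₀∈x)))
      ⊆δ₀ ε₀∈γ ¬c₀ x∈ε₀ (inj₂ (inj₁ refl)) = ⊥-elim (¬c₀ (inj₁ x∈ε₀))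
      ⊆δ₀ ε₀∈γ ¬c₀ x∈ε₀ (inj₂ (inj₂ x∈δ₀)) = x∈δ₀

    -- α is the ∈-least element of β ∖ α.
    Ordinal-⊂⇒∈ : {α β : M} → Ordinal S α → Ordinal S β → α ⊆ₛ β → ¬ α ≡ β → α ∈ β
    Ordinal-⊂⇒∈ {α} {β} (trα , _) ordβ@(trβ , _) α⊆β α≢β =
      let (z , z∈β , z∉α) = stable λ ¬diff → α≢β (extensionality α β λ x →
                              α⊆β x , λ x∈β → stable λ x∉α → ¬diff (x , x∈β , x∉α))
          (γ , γ∈β , γ∉α , γmin) = ∈-minimal (separation (¬⁺ (# 0 ∈⁺ # 1)) (α ∷ []) β) (z , z∈β , z∉α)
      in subst (_∈ β) (extensionality γ α λ x →
           (λ x∈γ → stable (γmin x x∈γ (trβ γ γ∈β x x∈γ))) , α⊆γ γ∈β γ∉α) γ∈β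
      where
      α⊆γ : {γ x : M} → γ ∈ β → γ ∉ α → x ∈ α → x ∈ γ
      α⊆γ {x = x} γ∈β γ∉α x∈α with ordinal-trichotomy ordβ (α⊆β x x∈α) γ∈β
      ... | inj₁ x∈γ = x∈γ
      ... | inj₂ (inj₁ refl) = ⊥-elim (γ∉α x∈α)
      ... | inj₂ (inj₂ γ∈x) = ⊥-elim (γ∉α (trα x x∈α _ γ∈x))

    Ordinal-succ : Ordinal S a → IsSucc S s a → Ordinal S s
    Ordinal-succ {a} {s} (tr , elems) hs = tr′ , elems′
      where
      tr′ : Transitive S s
      tr′ z z∈s y y∈z with proj₁ (hs z) z∈s
      ... | inj₁ z∈a = succ-⊇ hs (tr z z∈a y y∈z)
      ... | inj₂ refl = succ-⊇ hs y∈z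
      elems′ : (y : M) → y ∈ s → Transitive S y
      elems′ y y∈s with proj₁ (hs y) y∈s
      ... | inj₁ y∈a = elems y y∈a
      ... | inj₂ refl = tr

  lim : M
  lim = proj₁ infinity

  lim-limit : LimitOrdinal S lim
  lim-limit = proj₂ infinity

  opaque
    ∅∈lim : ∅ ∈ lim
    ∅∈lim with regularity lim (proj₁ (proj₂ lim-limit))
    ... | y , y∈lim , ymin =
      subst (_∈ lim) (≡∅ λ z z∈y → ymin z z∈y (proj₁ (proj₁ lim-limit) y y∈lim z z∈y)) y∈lim

    succ∈lim : b ∈ lim → IsSucc S s b → s ∈ lim
    succ∈lim {b} {s} b∈lim hs =
      Ordinal-⊂⇒∈ (Ordinal-succ (Ordinal-∈ ordLim b∈lim) hs) ordLim s⊆lim (λ { refl → proj₂ (proj₂ lim-limit) (b , hs) })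
      where
      ordLim : Ordinal S lim
      ordLim = proj₁ lim-limit
      s⊆lim : s ⊆ₛ lim
      s⊆lim z z∈s with proj₁ (hs z) z∈s
      ... | inj₁ z∈b = proj₁ ordLim b b∈lim z z∈b
      ... | inj₂ refl = b∈lim

    -- By ∈-induction on n ∪ {n}: each element is ∅ or a successor of a smaller one.
    NaturalNumber⇒∈lim : NaturalNumber S n → n ∈ lim
    NaturalNumber⇒∈lim {n} ((tr , _) , zeroOrSucc) =
      let (N , hN) = successor n
          N-trans : a ∈ N → b ∈ a → b ∈ N
          N-trans {a} {b} a∈N b∈a = case proj₁ (hN a) a∈N of λ
            { (inj₁ a∈n) → succ-⊇ hN (tr a a∈n b b∈a) ; (inj₂ refl) → succ-⊇ hN b∈a }
          step : (a : M) → a ∈ N → ((b : M) → b ∈ a → b ∈ N → b ∈ lim) → a ∈ lim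
          step a a∈N ih = case zeroOrSucc a (proj₁ (hN a) a∈N) of λ
            { (inj₁ a-empty) → subst (_∈ lim) (sym (≡∅ a-empty)) ∅∈lim
            ; (inj₂ (b , hb)) → succ∈lim (ih b (succ-∋ hb) (N-trans a∈N (succ-∋ hb))) hb }
      in ∈-induction (separation (# 0 ∈⁺ # 1) (lim ∷ []) N) step n (succ-∋ hN)

  opaque
    ω-separable : Separable lim (NaturalNumber S)
    ω-separable = separation (NaturalNumber⁺ (# 0)) [] lim

  ω : M
  ω = proj₁ ω-separable

  opaque
    ω-isOmega : IsOmega S ω
    ω-isOmega z = (λ z∈ω → proj₂ (proj₁ (proj₂ ω-separable z) z∈ω)) ,
                  (λ nz → proj₂ (proj₂ ω-separable z) (NaturalNumber⇒∈lim nz , nz))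

    ∈ω⇒NaturalNumber : n ∈ ω → NaturalNumber S n
    ∈ω⇒NaturalNumber {n} = proj₁ (ω-isOmega n)

    NaturalNumber⇒∈ω : NaturalNumber S n → n ∈ ω
    NaturalNumber⇒∈ω {n} = proj₂ (ω-isOmega n)

    ∈ω⇒∈lim : n ∈ ω → n ∈ lim
    ∈ω⇒∈lim {n} n∈ω = proj₁ (proj₁ (proj₂ ω-separable n) n∈ω)

    ∈ω⇒Ordinal : n ∈ ω → Ordinal S n
    ∈ω⇒Ordinal = proj₁ ∘ ∈ω⇒NaturalNumber

    ω-transitive : n ∈ ω → m ∈ n → m ∈ ω
    ω-transitive {n} {m} n∈ω m∈n = NaturalNumber⇒∈ω
      (Ordinal-∈ ordn m∈n , λ a a≤m → proj₂ (∈ω⇒NaturalNumber n∈ω) a (inj₁ (below a≤m)))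
      where
      ordn : Ordinal S n
      ordn = ∈ω⇒Ordinal n∈ω
      below : {a : M} → a ∈ m ⊎ a ≡ m → a ∈ n
      below (inj₁ a∈m) = proj₁ ordn m m∈n _ a∈m
      below (inj₂ refl) = m∈n

    succ∈ω : n ∈ ω → IsSucc S s n → s ∈ ω
    succ∈ω {n} {s} n∈ω hs = NaturalNumber⇒∈ω (Ordinal-succ (∈ω⇒Ordinal n∈ω) hs , zeroOrSucc)
      where
      zeroOrSucc : (a : M) → a ∈ s ⊎ a ≡ s → Empty S a ⊎ Σ M (IsSucc S a)
      zeroOrSucc a (inj₂ refl) = inj₂ (n , hs)
      zeroOrSucc a (inj₁ a∈s) with proj₁ (hs a) a∈s
      ... | inj₁ a∈n = proj₂ (∈ω⇒NaturalNumber n∈ω) a (inj₁ a∈n)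
      ... | inj₂ refl = proj₂ (∈ω⇒NaturalNumber n∈ω) a (inj₂ refl)

    ω-cases : n ∈ ω → Empty S n ⊎ Σ M λ b → b ∈ ω × IsSucc S n b
    ω-cases {n} n∈ω with proj₂ (∈ω⇒NaturalNumber n∈ω) n (inj₂ refl)
    ... | inj₁ e = inj₁ e
    ... | inj₂ (b , hb) = inj₂ (b , ω-transitive n∈ω (succ-∋ hb) , hb)

    ∅∈ω : ∅ ∈ ω
    ∅∈ω = NaturalNumber⇒∈ω (((λ y y∈∅ → ⊥-elim (∅-empty y y∈∅)) , (λ y y∈∅ → ⊥-elim (∅-empty y y∈∅))) ,
                           λ { a (inj₁ a∈∅) → ⊥-elim (∅-empty a a∈∅) ; a (inj₂ refl) → inj₁ ∅-empty })

    ω-trichotomy : m ∈ ω → n ∈ ω → Comparable m n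
    ω-trichotomy m∈ω n∈ω = ordinal-trichotomy (proj₁ lim-limit) (∈ω⇒∈lim m∈ω) (∈ω⇒∈lim n∈ω)

  succ : M → M
  succ x = proj₁ (successor x)

  opaque
    succ-IsSucc : (x : M) → IsSucc S (succ x) x
    succ-IsSucc x = proj₂ (successor x)

  opaque
    ω-induction : {P : M → Set} → Separable ω P → ((e : M) → Empty S e → P e) →
                  ((n s : M) → n ∈ ω → IsSucc S s n → P n → P s) → (n : M) → n ∈ ω → P n
    ω-induction {P} sp base step = ∈-induction sp λ n n∈ω ih → case ω-cases n∈ω of λ
      { (inj₁ e) → base n e
      ; (inj₂ (b , b∈ω , hb)) → step b n b∈ω hb (ih b (succ-∋ hb) b∈ω) }

    ω-strong-induction : {P : M → Set} → Separable ω P → ((n : M) → n ∈ ω → ((m : M) → m ∈ n → P m) → P n) →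
                         (n : M) → n ∈ ω → P n
    ω-strong-induction sp step = ∈-induction sp λ n n∈ω ih → step n n∈ω λ m m∈n → ih m m∈n (ω-transitive n∈ω m∈n)

  -- The order of ω

  _≤_ : M → M → Set
  x ≤ y = x ∈ y ⊎ x ≡ y

  opaque
    <-trans : c ∈ ω → a ∈ b → b ∈ c → a ∈ c
    <-trans c∈ω a∈b b∈c = proj₁ (∈ω⇒Ordinal c∈ω) _ b∈c _ a∈b

  ≤-trans : c ∈ ω → a ≤ b → b ≤ c → a ≤ c
  ≤-trans c∈ω (inj₁ a∈b) (inj₁ b∈c) = inj₁ (<-trans c∈ω a∈b b∈c)
  ≤-trans c∈ω (inj₁ a∈b) (inj₂ refl) = inj₁ a∈b
  ≤-trans c∈ω (inj₂ refl) b≤c = b≤c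

  <-≤-trans : c ∈ ω → a ∈ b → b ≤ c → a ∈ c
  <-≤-trans c∈ω a∈b (inj₁ b∈c) = <-trans c∈ω a∈b b∈c
  <-≤-trans c∈ω a∈b (inj₂ refl) = a∈b

  ≤-<-trans : c ∈ ω → a ≤ b → b ∈ c → a ∈ c
  ≤-<-trans c∈ω (inj₁ a∈b) b∈c = <-trans c∈ω a∈b b∈c
  ≤-<-trans c∈ω (inj₂ refl) b∈c = b∈c

  opaque
    ≤⇒≯ : a ≤ b → b ∉ a
    ≤⇒≯ (inj₁ a∈b) = ∈-asym a∈b
    ≤⇒≯ (inj₂ refl) = ∈-irrefl

    ≮⇒≥ : a ∈ ω → b ∈ ω → a ∉ b → b ≤ a
    ≮⇒≥ a∈ω b∈ω a∉b = case ω-trichotomy a∈ω b∈ω of λ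
      { (inj₁ a∈b) → ⊥-elim (a∉b a∈b) ; (inj₂ (inj₁ refl)) → inj₂ refl ; (inj₂ (inj₂ b∈a)) → inj₁ b∈a }

    ⊆⇒≤ : m ∈ ω → n ∈ ω → m ⊆ₛ n → m ≤ n
    ⊆⇒≤ {m} {n} m∈ω n∈ω m⊆n with lem (m ≡ n)
    ... | inj₁ m≡n = inj₂ m≡n
    ... | inj₂ m≢n = inj₁ (Ordinal-⊂⇒∈ (∈ω⇒Ordinal m∈ω) (∈ω⇒Ordinal n∈ω) m⊆n m≢n)

    <⇒succ≤ : m ∈ ω → n ∈ ω → IsSucc S s m → m ∈ n → s ≤ n
    <⇒succ≤ {m} {n} {s} m∈ω n∈ω hs m∈n = ⊆⇒≤ (succ∈ω m∈ω hs) n∈ω λ z z∈s → case proj₁ (hs z) z∈s of λ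
      { (inj₁ z∈m) → <-trans n∈ω z∈m m∈n ; (inj₂ refl) → m∈n }

    IsSucc-injective : a ∈ ω → b ∈ ω → IsSucc S s a → IsSucc S s b → a ≡ b
    IsSucc-injective a∈ω b∈ω ha hb with ω-trichotomy a∈ω b∈ω
    ... | inj₂ (inj₁ a≡b) = a≡b
    ... | inj₁ a∈b = case proj₁ (ha _) (succ-∋ hb) of λ
      { (inj₁ b∈a) → ⊥-elim (∈-asym a∈b b∈a) ; (inj₂ b≡a) → sym b≡a }
    ... | inj₂ (inj₂ b∈a) = case proj₁ (hb _) (succ-∋ ha) of λ
      { (inj₁ a∈b) → ⊥-elim (∈-asym a∈b b∈a) ; (inj₂ a≡b) → a≡b }

    zero≤ : n ∈ ω → Empty S n ⊎ ∅ ∈ n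
    zero≤ n∈ω = case ω-trichotomy ∅∈ω n∈ω of λ
      { (inj₁ ∅∈n) → inj₂ ∅∈n
      ; (inj₂ (inj₁ refl)) → inj₁ ∅-empty
      ; (inj₂ (inj₂ n∈∅)) → ⊥-elim (∅-empty _ n∈∅) }

  opaque
    finite-max : {D : M} → n ∈ ω → D ⊆ₛ n → Σ M (_∈ D) → Σ M λ b → b ∈ D × ((c : M) → c ∈ D → c ≤ b)
    finite-max {n = n} {D} n∈ω D⊆n (c , c∈D) =
      let (b , b∈D , _ , b-max) = ω-induction {P = λ j → Σ M (λ c → c ∈ D × c ∈ j) → Claim j}
            (separation ((∃∈⁺ (# 1) (# 0 ∈⁺ # 1)) ⇒⁺ ∃∈⁺ (# 1) (# 0 ∈⁺ # 1 ∧⁺ ∀∈⁺ (# 2) (# 0 ∈⁺ # 2 ⇒⁺ # 0 ∈⁺ # 1 ∨⁺ # 0 ≐⁺ # 1)))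
                        (D ∷ []) ω)
            (λ e e-empty (c , _ , c∈e) → ⊥-elim (e-empty c c∈e)) step n n∈ω (c , c∈D , D⊆n c c∈D)
      in b , b∈D , λ c′ c′∈D → b-max c′ c′∈D (D⊆n c′ c′∈D)
      where
      Claim : M → Set
      Claim j = Σ M λ b → b ∈ D × (b ∈ j × ((c : M) → c ∈ D → c ∈ j → c ≤ b))
      step : (j s : M) → j ∈ ω → IsSucc S s j → (Σ M (λ c → c ∈ D × c ∈ j) → Claim j) →
             Σ M (λ c → c ∈ D × c ∈ s) → Claim s
      step j s j∈ω hs ih (c , c∈D , c∈s) with lem (j ∈ D)
      ... | inj₁ j∈D = j , j∈D , succ-∋ hs , λ c′ _ c′∈s → proj₁ (hs c′) c′∈s
      ... | inj₂ j∉D =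
        let (b , b∈D , b∈j , b-max) = ih (c , c∈D , below c∈D c∈s) in
        b , b∈D , succ-⊇ hs b∈j , λ c′ c′∈D c′∈s → b-max c′ c′∈D (below c′∈D c′∈s)
        where
        below : {c′ : M} → c′ ∈ D → c′ ∈ s → c′ ∈ j
        below c′∈D c′∈s with proj₁ (hs _) c′∈s
        ... | inj₁ c′∈j = c′∈j
        ... | inj₂ refl = ⊥-elim (j∉D c′∈D)

  -- Relations and the collapse

  opaque
    product-∋ : IsProduct S c x y → a ∈ x → b ∈ y → IsOPair S o a b → o ∈ c
    product-∋ {o = o} hc a∈x b∈y ho = proj₂ (hc o) (_ , _ , a∈x , b∈y , ho)

    product-∈ : IsProduct S c x y → o ∈ c → IsOPair S o a b → a ∈ x × b ∈ y
    product-∈ {o = o} hc o∈c ho with proj₁ (hc o) o∈c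
    ... | a′ , b′ , a′∈x , b′∈y , ho′ with IsOPair-injective ho ho′
    ... | refl , refl = a′∈x , b′∈y

  RelationOn : M → (M → M → Set) → M → Set
  RelationOn X R r = (z : M) → z ∈ r ⟺ Σ M λ v → Σ M λ u → v ∈ X × u ∈ X × IsOPair S z v u × R v u

  opaque
    relationOn : {k : ℕ} (X : M) (φ : Fm⁺ (suc (suc k))) (ρ : Vec M k) →
                 Σ M (RelationOn X (λ v u → ⟦ φ ⟧⁺ (u ∷ v ∷ ρ)))
    relationOn X φ ρ with cartesian-product X X
    ... | c , hc with separation (∃⟨,⟩≐⁺ (# 0) (rename⁺ (lift 2 (1 ↑ʳ_)) φ)) ρ c
    ... | r , hr = r , λ z →
      (λ z∈r → let (z∈c , v , u , hz , hφ) = proj₁ (hr z) z∈r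
                   (v∈X , u∈X) = product-∈ hc z∈c hz
               in v , u , v∈X , u∈X , hz , proj₁ (weaken z v u) hφ) ,
      (λ (v , u , v∈X , u∈X , hz , hφ) → proj₂ (hr z) (product-∋ hc v∈X u∈X hz , v , u , hz , proj₂ (weaken z v u) hφ))
      where
      weaken : (z v u : M) → ⟦ rename⁺ (lift 2 (1 ↑ʳ_)) φ ⟧⁺ (u ∷ v ∷ z ∷ ρ) ⟺ ⟦ φ ⟧⁺ (u ∷ v ∷ ρ)
      weaken z v u = rename⁺-sound (lift 2 (1 ↑ʳ_)) φ (u ∷ v ∷ ρ) (u ∷ v ∷ z ∷ ρ) λ
        { zero → refl ; (suc zero) → refl ; (suc (suc i)) → refl }

  WellFoundedOn : M → (M → M → Set) → Set
  WellFoundedOn X R = (y : M) → y ⊆ₛ X → ¬ Empty S y → Σ M λ m → m ∈ y × ((v : M) → v ∈ y → ¬ R v m)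

  opaque
    ⊆∈⇒WellFoundedOn : {R : M → M → Set} → ((v u : M) → R v u → v ∈ u) → WellFoundedOn X R
    ⊆∈⇒WellFoundedOn R⊆∈ y _ y≢∅ with regularity y y≢∅
    ... | m , m∈y , mmin = m , m∈y , λ v v∈y r → mmin v (R⊆∈ v m r) v∈y

  opaque
    WellFoundedOn-⊆ : {R R′ : M → M → Set} → ((v u : M) → v ∈ X → u ∈ X → R v u → R′ v u) →
                      WellFoundedOn X R′ → WellFoundedOn X R
    WellFoundedOn-⊆ R⊆R′ wf y y⊆X y≢∅ with wf y y⊆X y≢∅
    ... | m , m∈y , m-min = m , m∈y , λ v v∈y r → m-min v v∈y (R⊆R′ v m (y⊆X v v∈y) (y⊆X m m∈y) r)

  module Lexicographic {k : ℕ} (κ : Fm⁺ (suc (suc (suc k)))) (ρ : Vec M k) where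

    Key : M → M → M → Set
    Key p n j = ⟦ κ ⟧⁺ (j ∷ n ∷ p ∷ ρ)

    _<ₗ_ : M → M → Set
    v <ₗ u = Σ M λ n′ → Σ M λ j′ → Σ M λ n → Σ M λ j →
            Key v n′ j′ × Key u n j × (n′ ∈ n ⊎ n′ ≡ n × j′ ∈ j)

    opaque
      primaryKeys : (y : M) → Separable ω (λ n → Σ M λ p → p ∈ y × Σ M λ j → j ∈ ω × Key p n j)
      primaryKeys y = Separable-cong
        (λ n _ → (λ (p , p∈y , j , j∈ω , key) → p , p∈y , j , j∈ω , proj₁ (reorder n p j) key) ,
                 (λ (p , p∈y , j , j∈ω , key) → p , p∈y , j , j∈ω , proj₂ (reorder n p j) key))
        (separation (∃∈⁺ (# 1) (∃∈⁺ (# 3) (rename⁺ ν κ))) (y ∷ ω ∷ ρ) ω)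
        where
        ν : Fin (suc (suc (suc k))) → Fin (suc (suc (suc (suc (suc k)))))
        ν zero = # 0
        ν (suc zero) = # 2
        ν (suc (suc zero)) = # 1
        ν (suc (suc (suc i))) = 5 ↑ʳ i
        reorder : (n p j : M) → ⟦ rename⁺ ν κ ⟧⁺ (j ∷ p ∷ n ∷ y ∷ ω ∷ ρ) ⟺ Key p n j
        reorder n p j = rename⁺-sound ν κ (j ∷ n ∷ p ∷ ρ) (j ∷ p ∷ n ∷ y ∷ ω ∷ ρ) λ
          { zero → refl ; (suc zero) → refl ; (suc (suc zero)) → refl ; (suc (suc (suc i))) → refl }

      secondaryKeys : (y n : M) → Separable ω (λ j → Σ M λ p → p ∈ y × Key p n j)
      secondaryKeys y n = Separable-cong
        (λ j _ → (λ (p , p∈y , key) → p , p∈y , proj₁ (reorder j p) key) ,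
                 (λ (p , p∈y , key) → p , p∈y , proj₂ (reorder j p) key))
        (separation (∃∈⁺ (# 1) (rename⁺ ν κ)) (y ∷ n ∷ ρ) ω)
        where
        ν : Fin (suc (suc (suc k))) → Fin (suc (suc (suc (suc k))))
        ν zero = # 1
        ν (suc zero) = # 3
        ν (suc (suc zero)) = # 0
        ν (suc (suc (suc i))) = 4 ↑ʳ i
        reorder : (j p : M) → ⟦ rename⁺ ν κ ⟧⁺ (p ∷ j ∷ y ∷ n ∷ ρ) ⟺ Key p n j
        reorder j p = rename⁺-sound ν κ (j ∷ n ∷ p ∷ ρ) (p ∷ j ∷ y ∷ n ∷ ρ) λ
          { zero → refl ; (suc zero) → refl ; (suc (suc zero)) → refl ; (suc (suc (suc i))) → refl }

      -- Minimise the primary key over y, then the secondary key among the points with that primary key.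
      <ₗ-wellFounded : (X : M) → ((p : M) → p ∈ X → Σ M λ n → Σ M λ j → n ∈ ω × j ∈ ω × Key p n j) →
                       ({p n j n′ j′ : M} → Key p n j → Key p n′ j′ → n ≡ n′ × j ≡ j′) →
                       WellFoundedOn X _<ₗ_
      <ₗ-wellFounded X keyed key-unique y y⊆X y≢∅ =
        let (p , p∈y) = stable λ ¬p → y≢∅ λ z z∈y → ¬p (z , z∈y)
            (n , j , n∈ω , j∈ω , key) = keyed p (y⊆X p p∈y)
            (n₀ , _ , (p₁ , p₁∈y , j₁ , j₁∈ω , key₁) , n₀-min) =
              ∈-minimal (primaryKeys y) (n , n∈ω , p , p∈y , j , j∈ω , key)
            (j₀ , _ , (p₀ , p₀∈y , key₀) , j₀-min) = ∈-minimal (secondaryKeys y n₀) (j₁ , j₁∈ω , p₁ , p₁∈y , key₁)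
        in p₀ , p₀∈y , no-smaller key₀ n₀-min j₀-min
        where
        no-smaller : {p₀ n₀ j₀ : M} → Key p₀ n₀ j₀ →
                     ((n′ : M) → n′ ∈ n₀ → n′ ∈ ω → ¬ Σ M λ p → p ∈ y × Σ M λ j → j ∈ ω × Key p n′ j) →
                     ((j′ : M) → j′ ∈ j₀ → j′ ∈ ω → ¬ Σ M λ p → p ∈ y × Key p n₀ j′) →
                     (v : M) → v ∈ y → ¬ v <ₗ p₀
        no-smaller key₀ n₀-min j₀-min v v∈y (n′ , j′ , _ , _ , key′ , key″ , lt) with keyed v (y⊆X v v∈y)
        ... | _ , _ , n′∈ω , j′∈ω , keyᵥ with key-unique keyᵥ key′ | key-unique key″ key₀
        ... | refl , refl | refl , refl with lt
        ... | inj₁ n′∈n₀ = n₀-min n′ n′∈n₀ n′∈ω (v , v∈y , j′ , j′∈ω , key′)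
        ... | inj₂ (refl , j′∈j₀) = j₀-min j′ j′∈j₀ j′∈ω (v , v∈y , key′)

  record Collapse (X : M) (R : M → M → Set) : Set where
    field
      image π : M
      function : IsFunction S π X image
      equation : (u k : M) → u ∈ X → Rel S π u k →
                 (z : M) → z ∈ k ⟺ Σ M λ v → v ∈ X × R v u × Rel S π v z

    opaque
      total : u ∈ X → Σ M (Rel S π u)
      total {u} u∈X = proj₁ (proj₂ function) u u∈X

      unique : Rel S π u x → Rel S π u y → x ≡ y
      unique = proj₂ (proj₂ function) _ _ _

      domain : Rel S π u x → u ∈ X × x ∈ image
      domain (z , hz , z∈π) with proj₁ function z z∈π
      ... | _ , _ , u∈X , x∈Y , hz′ with IsOPair-injective hz hz′
      ... | refl , refl = u∈X , x∈Y

      ∈-value : Rel S π u x → z ∈ x → Σ M λ v → v ∈ X × R v u × Rel S π v z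
      ∈-value {u} {x} {z} πux = proj₁ (equation u x (proj₁ (domain πux)) πux z)

      ∋-value : Rel S π u x → v ∈ X → R v u → Rel S π v z → z ∈ x
      ∋-value {u} {x} {v} {z} πux v∈X r πvz = proj₂ (equation u x (proj₁ (domain πux)) πux z) (v , v∈X , r , πvz)

      same-predecessors : Rel S π u x → Rel S π u′ x′ → ((v : M) → v ∈ X → R v u ⟺ R v u′) → x ≡ x′
      same-predecessors {x = x} {x′ = x′} πux πu′x′ eq = extensionality x x′ λ z →
        (λ z∈x → let (v , v∈X , r , πvz) = ∈-value πux z∈x in ∋-value πu′x′ v∈X (proj₁ (eq v v∈X) r) πvz) ,
        (λ z∈x′ → let (v , v∈X , r , πvz) = ∈-value πu′x′ z∈x′ in ∋-value πux v∈X (proj₂ (eq v v∈X) r) πvz)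

  opaque
    collapse : (X r : M) {R : M → M → Set} → RelationOn X R r → WellFoundedOn X R → Collapse X R
    collapse X r {R} hr wf with beta X r (r-on-X , wf-r)
      where
      r-on-X : (z : M) → z ∈ r → Σ M λ u → Σ M λ v → u ∈ X × v ∈ X × IsOPair S z u v
      r-on-X z z∈r = let (v , u , v∈X , u∈X , hz , _) = proj₁ (hr z) z∈r in v , u , v∈X , u∈X , hz
      wf-r : (y : M) → y ⊆ₛ X → ¬ Empty S y → Σ M λ m → m ∈ y × ((v : M) → v ∈ y → ¬ Rel S r v m)
      wf-r y y⊆X y≢∅ with wf y y⊆X y≢∅
      ... | m , m∈y , m-min = m , m∈y , λ v v∈y (z , hz , z∈r) → case proj₁ (hr z) z∈r of λ
        { (_ , _ , _ , _ , hz′ , rvm) → case IsOPair-injective hz hz′ of λ { (refl , refl) → m-min v v∈y rvm } }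
    ... | Y , _ , π , function , equation = record { image = Y ; π = π ; function = function ; equation = equation′ }
      where
      equation′ : (u k : M) → u ∈ X → Rel S π u k → (z : M) → z ∈ k ⟺ Σ M λ v → v ∈ X × R v u × Rel S π v z
      equation′ u k u∈X πuk z =
        (λ z∈k → let (v , v∈X , (o , ho , o∈r) , πvz) = proj₁ (equation u k u∈X πuk z) z∈k
                     (_ , _ , _ , _ , ho′ , rvu) = proj₁ (hr o) o∈r
                 in v , v∈X , subst₂ R (proj₁ (IsOPair-injective ho′ ho)) (proj₂ (IsOPair-injective ho′ ho)) rvu , πvz) ,
        (λ (v , v∈X , rvu , πvz) → let (o , ho) = opair v u in
          proj₂ (equation u k u∈X πuk z) (v , v∈X , (o , ho , proj₂ (hr o) (v , u , v∈X , u∈X , ho , rvu)) , πvz))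

  record Enumeration (T : M) : Set where
    field
      K σ : M
      K-natural : NaturalNumber S K
      σ-total : (a : M) → a ∈ T → Σ M λ i → i ∈ K × Rel S σ a i
      σ-unique : {a i i′ : M} → Rel S σ a i → Rel S σ a i′ → i ≡ i′
      σ-injective : {a a′ i : M} → a ∈ T → a′ ∈ T → Rel S σ a i → Rel S σ a′ i → a ≡ a′
      σ-surjective : (i : M) → i ∈ K → Σ M λ a → a ∈ T × Rel S σ a i

  -- The collapse of (T , ∈) enumerates a finite set T of naturals by a natural number.
  opaque
    enumerate : {T : M} → n ∈ ω → T ⊆ₛ n → Enumeration T
    enumerate {n} {T} n∈ω T⊆n = record
      { K = K ; σ = Rank.π ; K-natural = (K-transitive , K-elements-transitive) , zeroOrSucc
      ; σ-total = λ a a∈T → let (i , r) = Rank.total a∈T in i , K-∋ a∈T r , r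
      ; σ-unique = Rank.unique ; σ-injective = σ-injective
      ; σ-surjective = λ i i∈K → proj₂ (proj₁ (proj₂ K-separable i) i∈K) }
      where
      Rank-collapse : Collapse T _∈_
      Rank-collapse = collapse T _ (proj₂ (relationOn T (# 1 ∈⁺ # 0) [])) (⊆∈⇒WellFoundedOn λ _ _ v∈u → v∈u)
      module Rank = Collapse Rank-collapse
      T⊆ω : a ∈ T → a ∈ ω
      T⊆ω a∈T = ω-transitive n∈ω (T⊆n _ a∈T)
      K-separable : Separable Rank.image λ y → Σ M λ a → a ∈ T × Rel S Rank.π a y
      K-separable = separation (∃∈⁺ (# 2) (Rel⁺ (# 2) (# 0) (# 1))) (Rank.π ∷ T ∷ []) Rank.image
      K : M
      K = proj₁ K-separable
      K-∋ : a ∈ T → Rel S Rank.π a y → y ∈ K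
      K-∋ a∈T r = proj₂ (proj₂ K-separable _) (proj₂ (Rank.domain r) , _ , a∈T , r)
      σ-injective : {a a′ i : M} → a ∈ T → a′ ∈ T → Rel S Rank.π a i → Rel S Rank.π a′ i → a ≡ a′
      σ-injective a∈T a′∈T r r′ with ω-trichotomy (T⊆ω a∈T) (T⊆ω a′∈T)
      ... | inj₁ a∈a′ = ⊥-elim (∈-irrefl (Rank.∋-value r′ a∈T a∈a′ r))
      ... | inj₂ (inj₁ a≡a′) = a≡a′
      ... | inj₂ (inj₂ a′∈a) = ⊥-elim (∈-irrefl (Rank.∋-value r a′∈T a′∈a r′))
      K-transitive : Transitive S K
      K-transitive y y∈K x x∈y =
        let (_ , a , a∈T , r) = proj₁ (proj₂ K-separable y) y∈K ; (c , c∈T , _ , rc) = Rank.∈-value r x∈y in K-∋ c∈T rc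
      K-elements-transitive : (y : M) → y ∈ K → Transitive S y
      K-elements-transitive y y∈K x x∈y z z∈x =
        let (_ , a , a∈T , r) = proj₁ (proj₂ K-separable y) y∈K
            (c , c∈T , c∈a , rc) = Rank.∈-value r x∈y
            (d , d∈T , d∈c , rd) = Rank.∈-value rc z∈x
        in Rank.∋-value r d∈T (<-trans (T⊆ω a∈T) d∈c c∈a) rd
      -- The rank of a is the successor of the rank of the largest element of T below a, if any.
      rank-zeroOrSucc : a ∈ T → Rel S Rank.π a y → Empty S y ⊎ Σ M (IsSucc S y)
      rank-zeroOrSucc {a} {y} a∈T r with lem (Σ M λ c → c ∈ T × c ∈ a)
      ... | inj₂ none = inj₁ λ x x∈y → let (c , c∈T , c∈a , _) = Rank.∈-value r x∈y in none (c , c∈T , c∈a)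
      ... | inj₁ (c , c∈T , c∈a) =
        let D-separable = separation (# 0 ∈⁺ # 1) (a ∷ []) T
            D = proj₁ D-separable
            D∋ : {c : M} → c ∈ T → c ∈ a → c ∈ D
            D∋ c∈T c∈a = proj₂ (proj₂ D-separable _) (c∈T , c∈a)
            (b , b∈D , b-max) = finite-max (T⊆ω a∈T) (λ x x∈D → proj₂ (proj₁ (proj₂ D-separable x) x∈D)) (c , D∋ c∈T c∈a)
            (b∈T , b∈a) = proj₁ (proj₂ D-separable b) b∈D
            (yb , rb) = Rank.total b∈T
        in inj₂ (yb , λ x →
             (λ x∈y → let (c′ , c′∈T , c′∈a , rc′) = Rank.∈-value r x∈y in
                      case b-max c′ (D∋ c′∈T c′∈a) of λ
                        { (inj₁ c′∈b) → inj₁ (Rank.∋-value rb c′∈T c′∈b rc′)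
                        ; (inj₂ c′≡b) → inj₂ (Rank.unique rc′ (subst (λ c → Rel S Rank.π c yb) (sym c′≡b) rb)) }) ,
             (λ { (inj₁ x∈yb) → let (c′ , c′∈T , c′∈b , rc′) = Rank.∈-value rb x∈yb in
                                Rank.∋-value r c′∈T (<-trans (T⊆ω a∈T) c′∈b b∈a) rc′
                ; (inj₂ refl) → Rank.∋-value r b∈T b∈a rb }))
      K-zeroOrSucc : Empty S K ⊎ Σ M (IsSucc S K)
      K-zeroOrSucc with lem (Σ M (_∈ T))
      ... | inj₂ none = inj₁ λ x x∈K → let (_ , a , a∈T , _) = proj₁ (proj₂ K-separable x) x∈K in none (a , a∈T)
      ... | inj₁ nonempty =
        let (b , b∈T , b-max) = finite-max n∈ω T⊆n nonempty ; (yb , rb) = Rank.total b∈T in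
        inj₂ (yb , λ x →
          (λ x∈K → let (_ , c , c∈T , rc) = proj₁ (proj₂ K-separable x) x∈K in
                   case b-max c c∈T of λ
                     { (inj₁ c∈b) → inj₁ (Rank.∋-value rb c∈T c∈b rc)
                     ; (inj₂ c≡b) → inj₂ (Rank.unique rc (subst (λ c → Rel S Rank.π c yb) (sym c≡b) rb)) }) ,
          (λ { (inj₁ x∈yb) → let (c , c∈T , _ , rc) = Rank.∈-value rb x∈yb in K-∋ c∈T rc
             ; (inj₂ refl) → K-∋ b∈T rb }))
      zeroOrSucc : (y : M) → y ∈ K ⊎ y ≡ K → Empty S y ⊎ Σ M (IsSucc S y)
      zeroOrSucc y (inj₁ y∈K) = let (_ , a , a∈T , r) = proj₁ (proj₂ K-separable y) y∈K in rank-zeroOrSucc a∈T r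
      zeroOrSucc y (inj₂ refl) = K-zeroOrSucc

  -- Addition

  ω×ω : M
  ω×ω = proj₁ (cartesian-product ω ω)

  ω×ω-product : IsProduct S ω×ω ω ω
  ω×ω-product = proj₂ (cartesian-product ω ω)

  -- ⟨m′ , n′⟩ precedes ⟨m , n⟩ iff m′ = m and n′ < n, or n′ = 0 and m′ < m; the collapse then sends
  -- ⟨m , n⟩ to {m′ : m′ < m} ∪ {m + n′ : n′ < n} = m + n.
  AddStep : M → M → Set
  AddStep v u = Σ M λ m′ → Σ M λ n′ → IsOPair S v m′ n′ × Σ M λ m → Σ M λ n → IsOPair S u m n ×
                (m′ ≡ m × n′ ∈ n ⊎ Empty S n′ × m′ ∈ m)

  opaque
    AddStep-collapse : Collapse ω×ω AddStep
    AddStep-collapse =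
      collapse ω×ω _ (proj₂ (relationOn ω×ω (∃⟨,⟩≐⁺ (# 1) (∃⟨,⟩≐⁺ (# 2)
                                               (# 3 ≐⁺ # 1 ∧⁺ # 2 ∈⁺ # 0 ∨⁺ ∀∈⁺ (# 2) ⊥⁺ ∧⁺ # 3 ∈⁺ # 1))) []))
               (WellFoundedOn-⊆ AddStep⇒<ₗ (<ₗ-wellFounded ω×ω keyed key-unique))
      where
      open Lexicographic (∃⟨,⟩≐⁺ (# 2) (# 0 ≐⁺ # 3 ∧⁺ # 1 ≐⁺ # 2)) []
      keyed : (p : M) → p ∈ ω×ω → Σ M λ n → Σ M λ j → n ∈ ω × j ∈ ω × Key p n j
      keyed p p∈ω×ω = let (m , n , m∈ω , n∈ω , hp) = proj₁ (ω×ω-product p) p∈ω×ω in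
                      n , m , n∈ω , m∈ω , m , n , hp , refl , refl
      key-unique : Key p n j → Key p n′ j′ → n ≡ n′ × j ≡ j′
      key-unique (_ , _ , hp , refl , refl) (_ , _ , hp′ , refl , refl) =
        let (m≡m′ , n≡n′) = IsOPair-injective hp hp′ in n≡n′ , m≡m′
      AddStep⇒<ₗ : (v u : M) → v ∈ ω×ω → u ∈ ω×ω → AddStep v u → v <ₗ u
      AddStep⇒<ₗ v u _ u∈ω×ω (m′ , n′ , hv , m , n , hu , step) =
        n′ , m′ , n , m , (m′ , n′ , hv , refl , refl) , (m , n , hu , refl , refl) , order step
        where
        order : m′ ≡ m × n′ ∈ n ⊎ Empty S n′ × m′ ∈ m → n′ ∈ n ⊎ n′ ≡ n × m′ ∈ m
        order (inj₁ (_ , n′∈n)) = inj₁ n′∈n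
        order (inj₂ (n′-empty , m′∈m)) with zero≤ (proj₂ (product-∈ ω×ω-product u∈ω×ω hu))
        ... | inj₁ n-empty = inj₂ (empty-unique n′-empty n-empty , m′∈m)
        ... | inj₂ ∅∈n = inj₁ (subst (_∈ n) (sym (≡∅ n′-empty)) ∅∈n)

  module Sum = Collapse AddStep-collapse

  A : M
  A = Sum.π

  opaque
    Rel₂-functional : ((u a b : M) → Rel S c u a → Rel S c u b → a ≡ b) → Rel₂ S c m n x → Rel₂ S c m n y → x ≡ y
    Rel₂-functional c-functional (p , hp , r) (p′ , hp′ , r′) with IsOPair-unique hp hp′
    ... | refl = c-functional p _ _ r r′

    ω×ω-∋ : m ∈ ω → n ∈ ω → IsOPair S p m n → p ∈ ω×ω
    ω×ω-∋ = product-∋ ω×ω-product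

    sum : m ∈ ω → n ∈ ω → Σ M (Rel₂ S A m n)
    sum {m} {n} m∈ω n∈ω = let (p , hp) = opair m n ; (k , r) = Sum.total (ω×ω-∋ m∈ω n∈ω hp) in k , p , hp , r

    sum-unique : Rel₂ S A m n x → Rel₂ S A m n y → x ≡ y
    sum-unique = Rel₂-functional λ _ _ _ → Sum.unique

  opaque
    sum-zero : (m : M) → m ∈ ω → Rel₂ S A m ∅ m
    sum-zero = ω-strong-induction (separation (Rel₂⁺ (# 1) (# 0) (# 2) (# 0)) (A ∷ ∅ ∷ []) ω) step
      where
      step : (m : M) → m ∈ ω → ((m′ : M) → m′ ∈ m → Rel₂ S A m′ ∅ m′) → Rel₂ S A m ∅ m
      step m m∈ω ih =
        let (k , p , hp , r) = sum m∈ω ∅∈ω in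
        p , hp , subst (Rel S A p) (extensionality k m λ z → k⊆m hp r z , m⊆k hp r z) r
        where
        k⊆m : IsOPair S p m ∅ → Rel S A p k → (z : M) → z ∈ k → z ∈ m
        k⊆m hp r z z∈k with Sum.∈-value r z∈k
        ... | v , _ , (m′ , n′ , hv , _ , _ , hp′ , step) , πvz with IsOPair-injective hp′ hp
        ... | refl , refl with step
        ... | inj₁ (_ , n′∈∅) = ⊥-elim (∅-empty n′ n′∈∅)
        ... | inj₂ (n′-empty , m′∈m) with ih m′ m′∈m | ≡∅ n′-empty
        ... | p′ , hp″ , r′ | refl with IsOPair-unique hp″ hv
        ... | refl = subst (_∈ m) (Sum.unique r′ πvz) m′∈m
        m⊆k : IsOPair S p m ∅ → Rel S A p k → (z : M) → z ∈ m → z ∈ k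
        m⊆k hp r z z∈m = let (p′ , hp′ , r′) = ih z z∈m in
          Sum.∋-value r (ω×ω-∋ (ω-transitive m∈ω z∈m) ∅∈ω hp′) (z , ∅ , hp′ , m , ∅ , hp , inj₂ (∅-empty , z∈m)) r′

  opaque
    sum-succ : m ∈ ω → n ∈ ω → IsSucc S s n → Rel₂ S A m n k → Rel₂ S A m s k′ → IsSucc S k′ k
    sum-succ {m} {n} {s} {k} {k′} m∈ω n∈ω hs (p , hp , r) (p′ , hp′ , r′) z = to , from
      where
      to : z ∈ k′ → z ∈ k ⊎ z ≡ k
      to z∈k′ with Sum.∈-value r′ z∈k′
      ... | v , v∈ω×ω , (a , b , hv , _ , _ , hp″ , step) , πvz with IsOPair-injective hp″ hp′
      ... | refl , refl with step
      ... | inj₂ (b-empty , a∈m) = inj₁ (Sum.∋-value r v∈ω×ω (a , b , hv , m , n , hp , inj₂ (b-empty , a∈m)) πvz)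
      ... | inj₁ (refl , b∈s) with proj₁ (hs b) b∈s
      ...   | inj₁ b∈n = inj₁ (Sum.∋-value r v∈ω×ω (m , b , hv , m , n , hp , inj₁ (refl , b∈n)) πvz)
      ...   | inj₂ refl with IsOPair-unique hv hp
      ...     | refl = inj₂ (Sum.unique πvz r)
      from : z ∈ k ⊎ z ≡ k → z ∈ k′
      from (inj₂ refl) = Sum.∋-value r′ (proj₁ (Sum.domain r)) (m , n , hp , m , s , hp′ , inj₁ (refl , succ-∋ hs)) r
      from (inj₁ z∈k) with Sum.∈-value r z∈k
      ... | v , v∈ω×ω , (a , b , hv , _ , _ , hp″ , step) , πvz with IsOPair-injective hp″ hp
      ... | refl , refl = Sum.∋-value r′ v∈ω×ω (a , b , hv , m , s , hp′ , widen step) πvz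
        where
        widen : a ≡ m × b ∈ n ⊎ Empty S b × a ∈ m → a ≡ m × b ∈ s ⊎ Empty S b × a ∈ m
        widen (inj₁ (a≡m , b∈n)) = inj₁ (a≡m , succ-⊇ hs b∈n)
        widen (inj₂ step′) = inj₂ step′

    sum∈ω : m ∈ ω → n ∈ ω → Σ M λ k → k ∈ ω × Rel₂ S A m n k
    sum∈ω {m} {n} m∈ω =
      ω-induction (separation (∃∈⁺ (# 3) (Rel₂⁺ (# 2) (# 3) (# 1) (# 0))) (A ∷ m ∷ ω ∷ []) ω) base step n
      where
      base : (e : M) → Empty S e → Σ M λ k → k ∈ ω × Rel₂ S A m e k
      base e e-empty with ≡∅ e-empty
      ... | refl = m , m∈ω , sum-zero m m∈ω
      step : (n s : M) → n ∈ ω → IsSucc S s n → (Σ M λ k → k ∈ ω × Rel₂ S A m n k) → Σ M λ k → k ∈ ω × Rel₂ S A m s k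
      step n s n∈ω hs (k , k∈ω , r) = let (k′ , r′) = sum m∈ω (succ∈ω n∈ω hs) in
        k′ , succ∈ω k∈ω (sum-succ m∈ω n∈ω hs r r′) , r′

    A-isAddGraph : IsAddGraph S ω A
    A-isAddGraph = (elements , (λ m n m∈ω n∈ω → sum m∈ω n∈ω) , (λ _ _ _ _ → sum-unique)) ,
                   (λ m e m∈ω e-empty → subst (λ e → Rel₂ S A m e m) (sym (≡∅ e-empty)) (sum-zero m m∈ω)) ,
                   succ-rule
      where
      elements : (z : M) → z ∈ A → Σ M λ m → Σ M λ n → Σ M λ k →
                 m ∈ ω × n ∈ ω × k ∈ ω × Σ M λ p → IsOPair S p m n × IsOPair S z p k
      elements z z∈A =
        let (p , k , p∈ω×ω , _ , hz) = proj₁ Sum.function z z∈A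
            (m , n , m∈ω , n∈ω , hp) = proj₁ (ω×ω-product p) p∈ω×ω
            (k₀ , k₀∈ω , r) = sum∈ω m∈ω n∈ω
        in m , n , k , m∈ω , n∈ω , subst (_∈ ω) (sum-unique r (p , hp , z , hz , z∈A)) k₀∈ω , p , hp , hz
      succ-rule : (m n s k k′ : M) → m ∈ ω → n ∈ ω → IsSucc S s n → IsSucc S k′ k →
                  Rel₂ S A m n k → Rel₂ S A m s k′
      succ-rule m n s k k′ m∈ω n∈ω hs hk r =
        let (j , r′) = sum m∈ω (succ∈ω n∈ω hs) in
        subst (Rel₂ S A m s) (IsSucc-unique (sum-succ m∈ω n∈ω hs r r′) hk) r′

  opaque
    Rel₂-∈ω : IsBinOpGraph S ω g → Rel₂ S g m n k → m ∈ ω × n ∈ ω × k ∈ ω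
    Rel₂-∈ω (elements , _) (p , hp , z , hz , z∈g) with elements z z∈g
    ... | _ , _ , _ , m∈ω , n∈ω , k∈ω , p′ , hp′ , hz′ with IsOPair-injective hz hz′
    ... | refl , refl with IsOPair-injective hp hp′
    ... | refl , refl = m∈ω , n∈ω , k∈ω

  module AdditionGraph (A : M) (isAdd : IsAddGraph S ω A) where

    infix 4 _+_≈_
    _+_≈_ : M → M → M → Set
    m + n ≈ k = Rel₂ S A m n k

    opaque
      +-∈ω : m + n ≈ k → m ∈ ω × n ∈ ω × k ∈ ω
      +-∈ω = Rel₂-∈ω (proj₁ isAdd)

      +-unique : m + n ≈ k → m + n ≈ k′ → k ≡ k′
      +-unique = proj₂ (proj₂ (proj₁ isAdd)) _ _ _ _

      +-total : m ∈ ω → n ∈ ω → Σ M (m + n ≈_)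
      +-total = proj₁ (proj₂ (proj₁ isAdd)) _ _

      +-identityʳ : m ∈ ω → Empty S e → m + e ≈ m
      +-identityʳ = proj₁ (proj₂ isAdd) _ _

      +-suc : m ∈ ω → n ∈ ω → IsSucc S s n → IsSucc S k′ k → m + n ≈ k → m + s ≈ k′
      +-suc = proj₂ (proj₂ isAdd) _ _ _ _ _

      +-suc⁻¹ : IsSucc S s n → m + s ≈ k′ → Σ M λ k → m + n ≈ k × IsSucc S k′ k
      +-suc⁻¹ {s} {n} {m} {k′} hs r′ =
        let (m∈ω , s∈ω , _) = +-∈ω r′
            n∈ω = ω-transitive s∈ω (succ-∋ hs)
            (k , r) = +-total m∈ω n∈ω
        in k , r , subst (λ k′ → IsSucc S k′ k) (+-unique (+-suc m∈ω n∈ω hs (succ-IsSucc k) r) r′) (succ-IsSucc k)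

  module Multiplication (A : M) (isAdd : IsAddGraph S ω A) where
    open AdditionGraph A isAdd

    ω×ω×ω : M
    ω×ω×ω = proj₁ (cartesian-product ω×ω ω)

    ω×ω×ω-product : IsProduct S ω×ω×ω ω×ω ω
    ω×ω×ω-product = proj₂ (cartesian-product ω×ω ω)

    -- ⟨⟨m , n′⟩ , j′⟩ precedes ⟨⟨m , n⟩ , j⟩ iff n′ < n and j′ < m, or n′ = n and j′ < j; the collapse then
    -- sends ⟨⟨m , n⟩ , j⟩ to m · n + j.
    MulStep : M → M → Set
    MulStep v u = Σ M λ a′ → Σ M λ j′ → IsOPair S v a′ j′ × Σ M λ m′ → Σ M λ n′ → IsOPair S a′ m′ n′ ×
                  Σ M λ a → Σ M λ j → IsOPair S u a j × Σ M λ m → Σ M λ n → IsOPair S a m n ×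
                  (m′ ≡ m × (n′ ∈ n × j′ ∈ m ⊎ n′ ≡ n × j′ ∈ j))

    MulStepAt : M → M → M → M → Set
    MulStepAt v m n j = Σ M λ a′ → Σ M λ j′ → IsOPair S v a′ j′ × Σ M λ m′ → Σ M λ n′ → IsOPair S a′ m′ n′ ×
                        (m′ ≡ m × (n′ ∈ n × j′ ∈ m ⊎ n′ ≡ n × j′ ∈ j))

    opaque
      MulStep-at : IsOPair S u a j → IsOPair S a m n → MulStep v u ⟺ MulStepAt v m n j
      MulStep-at hu ha =
        (λ { (a′ , j′ , hv , m′ , n′ , ha′ , _ , _ , hu′ , _ , _ , ha″ , step) →
               case IsOPair-injective hu hu′ of λ { (refl , refl) →
               case IsOPair-injective ha ha″ of λ { (refl , refl) → a′ , j′ , hv , m′ , n′ , ha′ , step } } }) ,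
        (λ (a′ , j′ , hv , m′ , n′ , ha′ , step) → a′ , j′ , hv , m′ , n′ , ha′ , _ , _ , hu , _ , _ , ha , step)

      MulStep-collapse : Collapse ω×ω×ω MulStep
      MulStep-collapse =
        collapse ω×ω×ω _
          (proj₂ (relationOn ω×ω×ω (∃⟨,⟩≐⁺ (# 1) (∃⟨,⟩≐⁺ (# 1) (∃⟨,⟩≐⁺ (# 4) (∃⟨,⟩≐⁺ (# 1)
            (# 5 ≐⁺ # 1 ∧⁺ (# 4 ∈⁺ # 0 ∧⁺ # 6 ∈⁺ # 1 ∨⁺ # 4 ≐⁺ # 0 ∧⁺ # 6 ∈⁺ # 2)))))) []))
          (WellFoundedOn-⊆ MulStep⇒<ₗ (<ₗ-wellFounded ω×ω×ω keyed key-unique))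
        where
        open Lexicographic (∃⟨,⟩≐⁺ (# 2) (∃⟨,⟩≐⁺ (# 1) (# 0 ≐⁺ # 5 ∧⁺ # 2 ≐⁺ # 4))) []
        keyed : (p : M) → p ∈ ω×ω×ω → Σ M λ n → Σ M λ j → n ∈ ω × j ∈ ω × Key p n j
        keyed p p∈ω×ω×ω =
          let (a , j , a∈ω×ω , j∈ω , hp) = proj₁ (ω×ω×ω-product p) p∈ω×ω×ω
              (m , n , m∈ω , n∈ω , ha) = proj₁ (ω×ω-product a) a∈ω×ω
          in n , j , n∈ω , j∈ω , a , j , hp , m , n , ha , refl , refl
        key-unique : Key p n j → Key p n′ j′ → n ≡ n′ × j ≡ j′
        key-unique (_ , _ , hp , _ , _ , ha , refl , refl) (_ , _ , hp′ , _ , _ , ha′ , refl , refl)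
          with IsOPair-injective hp hp′
        ... | refl , refl with IsOPair-injective ha ha′
        ... | refl , refl = refl , refl
        MulStep⇒<ₗ : (v u : M) → v ∈ ω×ω×ω → u ∈ ω×ω×ω → MulStep v u → v <ₗ u
        MulStep⇒<ₗ v u _ _ (a′ , j′ , hv , m′ , n′ , ha′ , a , j , hu , m , n , ha , _ , step) =
          n′ , j′ , n , j , (a′ , j′ , hv , m′ , n′ , ha′ , refl , refl) , (a , j , hu , m , n , ha , refl , refl) ,
          order step
          where
          order : n′ ∈ n × j′ ∈ m ⊎ n′ ≡ n × j′ ∈ j → n′ ∈ n ⊎ n′ ≡ n × j′ ∈ j
          order (inj₁ (n′∈n , _)) = inj₁ n′∈n
          order (inj₂ step′) = inj₂ step′

    module MulAdd = Collapse MulStep-collapse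

    infix 4 _·_+_≈_
    _·_+_≈_ : M → M → M → M → Set
    m · n + j ≈ t = Rel₃ MulAdd.π m n j t

    opaque
      mulAdd : m ∈ ω → n ∈ ω → j ∈ ω → Σ M λ t → m · n + j ≈ t
      mulAdd {m} {n} {j} m∈ω n∈ω j∈ω =
        let (a , ha) = opair m n ; (p , hp) = opair a j
            (t , r) = MulAdd.total (product-∋ ω×ω×ω-product (ω×ω-∋ m∈ω n∈ω ha) j∈ω hp)
        in t , a , ha , p , hp , r

      mulAdd-unique : m · n + j ≈ t → m · n + j ≈ t′ → t ≡ t′
      mulAdd-unique (a , ha , r) (a′ , ha′ , r′) with IsOPair-unique ha ha′
      ... | refl = Rel₂-functional (λ _ _ _ → MulAdd.unique) r r′

      mulAdd-suc : IsSucc S j′ j → m · n + j ≈ t → m · n + j′ ≈ t′ → IsSucc S t′ t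
      mulAdd-suc {j′} {j} {m} {n} {t} {t′} hj (a , ha , p , hp , r) (a₂ , ha₂ , p′ , hp′ , r′) z
        with IsOPair-unique ha ha₂
      ... | refl = to , from
        where
        to : z ∈ t′ → z ∈ t ⊎ z ≡ t
        to z∈t′ with MulAdd.∈-value r′ z∈t′
        ... | v , v∈X , step , πvz with proj₁ (MulStep-at hp′ ha) step
        ... | a″ , j″ , hv , m″ , n″ , ha″ , m″≡m , inj₁ below =
          inj₁ (MulAdd.∋-value r v∈X (proj₂ (MulStep-at hp ha) (a″ , j″ , hv , m″ , n″ , ha″ , m″≡m , inj₁ below)) πvz)
        ... | a″ , j″ , hv , m″ , n″ , ha″ , m″≡m , inj₂ (n″≡n , j″∈j′) with proj₁ (hj j″) j″∈j′
        ...   | inj₁ j″∈j =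
          inj₁ (MulAdd.∋-value r v∈X (proj₂ (MulStep-at hp ha) (a″ , j″ , hv , m″ , n″ , ha″ , m″≡m , inj₂ (n″≡n , j″∈j))) πvz)
        ...   | inj₂ refl with m″≡m | n″≡n
        ...     | refl | refl with IsOPair-unique ha″ ha
        ...       | refl with IsOPair-unique hv hp
        ...         | refl = inj₂ (MulAdd.unique πvz r)
        from : z ∈ t ⊎ z ≡ t → z ∈ t′
        from (inj₂ refl) =
          MulAdd.∋-value r′ (proj₁ (MulAdd.domain r)) (proj₂ (MulStep-at hp′ ha) (a , j , hp , m , n , ha , refl , inj₂ (refl , succ-∋ hj))) r
        from (inj₁ z∈t) with MulAdd.∈-value r z∈t
        ... | v , v∈X , step , πvz with proj₁ (MulStep-at hp ha) step
        ... | a″ , j″ , hv , m″ , n″ , ha″ , m″≡m , below =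
          MulAdd.∋-value r′ v∈X (proj₂ (MulStep-at hp′ ha) (a″ , j″ , hv , m″ , n″ , ha″ , m″≡m , widen below)) πvz
          where
          widen : n″ ∈ n × j″ ∈ m ⊎ n″ ≡ n × j″ ∈ j → n″ ∈ n × j″ ∈ m ⊎ n″ ≡ n × j″ ∈ j′
          widen (inj₁ below′) = inj₁ below′
          widen (inj₂ (n″≡n , j″∈j)) = inj₂ (n″≡n , succ-⊇ hj j″∈j)

      mulAdd-zero : m · ∅ + ∅ ≈ t → Empty S t
      mulAdd-zero (a , ha , p , hp , r) z z∈t with MulAdd.∈-value r z∈t
      ... | v , _ , step , _ with proj₁ (MulStep-at hp ha) step
      ... | _ , j′ , _ , _ , n′ , _ , _ , inj₁ (n′∈∅ , _) = ∅-empty n′ n′∈∅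
      ... | _ , j′ , _ , _ , n′ , _ , _ , inj₂ (_ , j′∈∅) = ∅-empty j′ j′∈∅

      -- ⟨⟨m , n + 1⟩ , 0⟩ and ⟨⟨m , n⟩ , m⟩ have the same predecessors.
      mulAdd-carry : IsSucc S s n → m · s + ∅ ≈ t → m · n + m ≈ t′ → t ≡ t′
      mulAdd-carry {s} {n} {m} hs (a , ha , p , hp , r) (a′ , ha′ , p′ , hp′ , r′) =
        MulAdd.same-predecessors r r′ λ v _ →
          (λ step → proj₂ (MulStep-at hp′ ha′) (to (proj₁ (MulStep-at hp ha) step))) ,
          (λ step → proj₂ (MulStep-at hp ha) (from (proj₁ (MulStep-at hp′ ha′) step)))
        where
        to : MulStepAt v m s ∅ → MulStepAt v m n m
        to (a″ , j″ , hv , m″ , n″ , ha″ , m″≡m , inj₁ (n″∈s , j″∈m)) with proj₁ (hs n″) n″∈s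
        ... | inj₁ n″∈n = a″ , j″ , hv , m″ , n″ , ha″ , m″≡m , inj₁ (n″∈n , j″∈m)
        ... | inj₂ n″≡n = a″ , j″ , hv , m″ , n″ , ha″ , m″≡m , inj₂ (n″≡n , j″∈m)
        to (_ , j″ , _ , _ , _ , _ , _ , inj₂ (_ , j″∈∅)) = ⊥-elim (∅-empty j″ j″∈∅)
        from : MulStepAt v m n m → MulStepAt v m s ∅
        from (a″ , j″ , hv , m″ , n″ , ha″ , m″≡m , inj₁ (n″∈n , j″∈m)) =
          a″ , j″ , hv , m″ , n″ , ha″ , m″≡m , inj₁ (succ-⊇ hs n″∈n , j″∈m)
        from (a″ , j″ , hv , m″ , n″ , ha″ , m″≡m , inj₂ (refl , j″∈m)) =
          a″ , j″ , hv , m″ , n″ , ha″ , m″≡m , inj₁ (succ-∋ hs , j″∈m)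

      mulAdd-offset : m ∈ ω → n ∈ ω → k ∈ ω → m · n + ∅ ≈ k → j ∈ ω → Σ M λ t → (m · n + j ≈ t) × k + j ≈ t
      mulAdd-offset {m} {n} {k} {j} m∈ω n∈ω k∈ω hk j∈ω =
        let (t , _ , ht , kj) = ω-induction {P = λ j → Σ M λ t → t ∈ MulAdd.image × (m · n + j ≈ t) × k + j ≈ t}
              (separation (∃∈⁺ (# 1) (Rel₃⁺ (# 3) (# 4) (# 5) (# 1) (# 0) ∧⁺ Rel₂⁺ (# 7) (# 6) (# 1) (# 0)))
                          (MulAdd.image ∷ MulAdd.π ∷ m ∷ n ∷ k ∷ A ∷ []) ω)
              base step j j∈ω
        in t , ht , kj
        where
        base : (e : M) → Empty S e → Σ M λ t → t ∈ MulAdd.image × (m · n + e ≈ t) × k + e ≈ t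
        base e e-empty with ≡∅ e-empty
        ... | refl = let (_ , _ , _ , _ , r) = hk in k , proj₂ (MulAdd.domain r) , hk , +-identityʳ k∈ω e-empty
        step : (j s : M) → j ∈ ω → IsSucc S s j → (Σ M λ t → t ∈ MulAdd.image × (m · n + j ≈ t) × k + j ≈ t) →
               Σ M λ t → t ∈ MulAdd.image × (m · n + s ≈ t) × k + s ≈ t
        step j s j∈ω hs (t , _ , ht , kj) =
          let (t′ , ht′) = mulAdd m∈ω n∈ω (succ∈ω j∈ω hs) ; (_ , _ , _ , _ , r′) = ht′ in
          t′ , proj₂ (MulAdd.domain r′) , ht′ , +-suc k∈ω j∈ω hs (mulAdd-suc hs ht ht′) kj

      mulAdd-∈ω : m ∈ ω → n ∈ ω → Σ M λ k → k ∈ ω × m · n + ∅ ≈ k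
      mulAdd-∈ω {m} {n} m∈ω =
        ω-induction (separation (∃∈⁺ (# 2) (Rel₃⁺ (# 2) (# 4) (# 1) (# 5) (# 0))) (MulAdd.π ∷ ω ∷ m ∷ ∅ ∷ []) ω)
                    base step n
        where
        base : (e : M) → Empty S e → Σ M λ k → k ∈ ω × m · e + ∅ ≈ k
        base e e-empty with ≡∅ e-empty
        ... | refl = let (t , ht) = mulAdd m∈ω ∅∈ω ∅∈ω in t , subst (_∈ ω) (sym (≡∅ (mulAdd-zero ht))) ∅∈ω , ht
        step : (n s : M) → n ∈ ω → IsSucc S s n →
               (Σ M λ k → k ∈ ω × m · n + ∅ ≈ k) → Σ M λ k → k ∈ ω × m · s + ∅ ≈ k
        step n s n∈ω hs (k , k∈ω , hk) =
          let (t , ht , kt) = mulAdd-offset m∈ω n∈ω k∈ω hk m∈ω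
              (t′ , ht′) = mulAdd m∈ω (succ∈ω n∈ω hs) ∅∈ω
          in t′ , subst (_∈ ω) (sym (mulAdd-carry hs ht′ ht)) (proj₂ (proj₂ (+-∈ω kt))) , ht′

    opaque
      P-separable : Separable ω×ω×ω λ z → Σ M λ a → Σ M λ t → IsOPair S z a t × Σ M λ m → Σ M λ n → IsOPair S a m n ×
                                                               m · n + ∅ ≈ t
      P-separable = separation (∃⟨,⟩≐⁺ (# 0) (∃⟨,⟩≐⁺ (# 1) (Rel₃⁺ (# 5) (# 1) (# 0) (# 6) (# 2)))) (MulAdd.π ∷ ∅ ∷ []) ω×ω×ω

    P : M
    P = proj₁ P-separable

    opaque
      P-∋ : m ∈ ω → n ∈ ω → k ∈ ω → m · n + ∅ ≈ k → Rel₂ S P m n k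
      P-∋ {m} {n} {k} m∈ω n∈ω k∈ω hk =
        let (a , ha) = opair m n ; (z , hz) = opair a k in
        a , ha , z , hz , proj₂ (proj₂ P-separable z)
          (product-∋ ω×ω×ω-product (ω×ω-∋ m∈ω n∈ω ha) k∈ω hz , a , k , hz , m , n , ha , hk)

      P-∈ : Rel₂ S P m n k → m · n + ∅ ≈ k
      P-∈ (a , ha , z , hz , z∈P) with proj₂ (proj₁ (proj₂ P-separable z) z∈P)
      ... | _ , _ , hz′ , _ , _ , ha′ , hk with IsOPair-injective hz hz′
      ... | refl , refl with IsOPair-injective ha ha′
      ... | refl , refl = hk

      P-isMulGraph : IsMulGraph S ω A P
      P-isMulGraph = (elements , total , (λ _ _ _ _ r r′ → mulAdd-unique (P-∈ r) (P-∈ r′))) , zero-rule , succ-rule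
        where
        elements : (z : M) → z ∈ P → Σ M λ m → Σ M λ n → Σ M λ k →
                   m ∈ ω × n ∈ ω × k ∈ ω × Σ M λ p → IsOPair S p m n × IsOPair S z p k
        elements z z∈P =
          let (z∈X , a , t , hz , m , n , ha , _) = proj₁ (proj₂ P-separable z) z∈P
              (a∈ω×ω , t∈ω) = product-∈ ω×ω×ω-product z∈X hz
              (m∈ω , n∈ω) = product-∈ ω×ω-product a∈ω×ω ha
          in m , n , t , m∈ω , n∈ω , t∈ω , a , ha , hz
        total : (m n : M) → m ∈ ω → n ∈ ω → Σ M (Rel₂ S P m n)
        total m n m∈ω n∈ω = let (k , k∈ω , hk) = mulAdd-∈ω m∈ω n∈ω in k , P-∋ m∈ω n∈ω k∈ω hk
        zero-rule : (m e : M) → m ∈ ω → Empty S e → Rel₂ S P m e e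
        zero-rule m e m∈ω e-empty with ≡∅ e-empty | mulAdd m∈ω ∅∈ω ∅∈ω
        ... | refl | t , ht with ≡∅ (mulAdd-zero ht)
        ...   | refl = P-∋ m∈ω ∅∈ω ∅∈ω ht
        succ-rule : (m n s k j : M) → m ∈ ω → n ∈ ω → IsSucc S s n → Rel₂ S P m n k → k + m ≈ j → Rel₂ S P m s j
        succ-rule m n s k j m∈ω n∈ω hs mnk kmj =
          let (k′ , k′∈ω , hk′) = mulAdd-∈ω m∈ω n∈ω
              hk = P-∈ mnk
              (t , ht , kmt) = mulAdd-offset m∈ω n∈ω (subst (_∈ ω) (mulAdd-unique hk′ hk) k′∈ω) hk m∈ω
              (t′ , ht′) = mulAdd m∈ω (succ∈ω n∈ω hs) ∅∈ω
              t′≡j = trans (mulAdd-carry hs ht′ ht) (+-unique kmt kmj)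
          in subst (Rel₂ S P m s) t′≡j (P-∋ m∈ω (succ∈ω n∈ω hs) (subst (_∈ ω) (sym t′≡j) (proj₂ (proj₂ (+-∈ω kmj)))) ht′)

  -- Arithmetic from the recursion equations

  module Arithmetic (A P : M) (isAdd : IsAddGraph S ω A) (isMul : IsMulGraph S ω A P) where
    open AdditionGraph A isAdd public

    infix 4 _·_≈_
    _·_≈_ : M → M → M → Set
    m · n ≈ k = Rel₂ S P m n k

    opaque
      ·-∈ω : m · n ≈ k → m ∈ ω × n ∈ ω × k ∈ ω
      ·-∈ω = Rel₂-∈ω (proj₁ isMul)

      ·-unique : m · n ≈ k → m · n ≈ k′ → k ≡ k′
      ·-unique = proj₂ (proj₂ (proj₁ isMul)) _ _ _ _

      ·-total : m ∈ ω → n ∈ ω → Σ M (m · n ≈_)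
      ·-total = proj₁ (proj₂ (proj₁ isMul)) _ _

      ·-zeroʳ : m ∈ ω → Empty S e → m · e ≈ e
      ·-zeroʳ = proj₁ (proj₂ isMul) _ _

      ·-suc : IsSucc S s n → m · n ≈ k → k + m ≈ j → m · s ≈ j
      ·-suc hs r r′ = let (m∈ω , n∈ω , _) = ·-∈ω r in proj₂ (proj₂ isMul) _ _ _ _ _ m∈ω n∈ω hs r r′

      +-identityˡ : n ∈ ω → ∅ + n ≈ n
      +-identityˡ {n} = ω-induction (separation (Rel₂⁺ (# 1) (# 2) (# 0) (# 0)) (A ∷ ∅ ∷ []) ω)
        (λ e e-empty → subst (∅ + e ≈_) (sym (≡∅ e-empty)) (+-identityʳ ∅∈ω e-empty))
        (λ n s n∈ω hs ih → +-suc ∅∈ω n∈ω hs hs ih) n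

      +-sucˡ : IsSucc S a′ a → a + b ≈ c → IsSucc S c′ c → a′ + b ≈ c′
      +-sucˡ {a′} {a} {b} {c} {c′} ha r hc =
        let (a∈ω , b∈ω , c∈ω) = +-∈ω r in
        ω-induction (separation (∀∈⁺ (# 4) (Rel₂⁺ (# 4) (# 2) (# 1) (# 0) ⇒⁺
                                  ∀∈⁺ (# 5) (IsSucc⁺ (# 0) (# 1) ⇒⁺ Rel₂⁺ (# 5) (# 4) (# 2) (# 0))))
                                (a ∷ a′ ∷ A ∷ ω ∷ []) ω)
                    (base a∈ω) (step a∈ω) b b∈ω c c∈ω r c′ (succ∈ω c∈ω hc) hc
        where
        Claim : M → Set
        Claim b = (c : M) → c ∈ ω → a + b ≈ c → (c′ : M) → c′ ∈ ω → IsSucc S c′ c → a′ + b ≈ c′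
        base : a ∈ ω → (e : M) → Empty S e → Claim e
        base a∈ω e e-empty c _ r c′ _ hc with +-unique (+-identityʳ a∈ω e-empty) r
        ... | refl with IsSucc-unique ha hc
        ... | refl = +-identityʳ (succ∈ω a∈ω ha) e-empty
        step : a ∈ ω → (b s : M) → b ∈ ω → IsSucc S s b → Claim b → Claim s
        step a∈ω b s b∈ω hs ih c c∈ω r c′ _ hc =
          let (d , rd , hcd) = +-suc⁻¹ hs r in
          +-suc (succ∈ω a∈ω ha) b∈ω hs hc (ih d (proj₂ (proj₂ (+-∈ω rd))) rd c c∈ω hcd)

      +-comm : a + b ≈ c → b + a ≈ c
      +-comm {a} {b} {c} r =
        let (a∈ω , b∈ω , c∈ω) = +-∈ω r in
        ω-induction (separation (∀∈⁺ (# 2) (∀∈⁺ (# 3) (Rel₂⁺ (# 3) (# 1) (# 2) (# 0) ⇒⁺ Rel₂⁺ (# 3) (# 2) (# 1) (# 0))))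
                                (A ∷ ω ∷ []) ω)
                    base step b b∈ω a a∈ω c c∈ω r
        where
        Claim : M → Set
        Claim b = (a : M) → a ∈ ω → (c : M) → c ∈ ω → a + b ≈ c → b + a ≈ c
        base : (e : M) → Empty S e → Claim e
        base e e-empty a a∈ω c _ r with +-unique (+-identityʳ a∈ω e-empty) r | ≡∅ e-empty
        ... | refl | refl = +-identityˡ a∈ω
        step : (b s : M) → b ∈ ω → IsSucc S s b → Claim b → Claim s
        step b s b∈ω hs ih a a∈ω c _ r =
          let (d , rd , hcd) = +-suc⁻¹ hs r in
          +-sucˡ hs (ih a a∈ω d (proj₂ (proj₂ (+-∈ω rd))) rd) hcd

      +-assoc : a + b ≈ ab → b + c ≈ bc → ab + c ≈ r → a + bc ≈ r
      +-assoc {a} {b} {ab} {c} {bc} {r} r₁ r₂ r₃ =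
        let (a∈ω , b∈ω , ab∈ω) = +-∈ω r₁ ; (_ , c∈ω , bc∈ω) = +-∈ω r₂ ; (_ , _ , r∈ω) = +-∈ω r₃ in
        ω-induction (separation (∀∈⁺ (# 2) (∀∈⁺ (# 3) (∀∈⁺ (# 4) (∀∈⁺ (# 5) (∀∈⁺ (# 6)
                      (Rel₂⁺ (# 6) (# 4) (# 3) (# 2) ⇒⁺ Rel₂⁺ (# 6) (# 3) (# 5) (# 1) ⇒⁺
                       Rel₂⁺ (# 6) (# 2) (# 5) (# 0) ⇒⁺ Rel₂⁺ (# 6) (# 4) (# 1) (# 0)))))))
                      (A ∷ ω ∷ []) ω)
                    base step c c∈ω a a∈ω b b∈ω ab ab∈ω bc bc∈ω r r∈ω r₁ r₂ r₃
        where
        Claim : M → Set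
        Claim c = (a : M) → a ∈ ω → (b : M) → b ∈ ω → (ab : M) → ab ∈ ω → (bc : M) → bc ∈ ω → (r : M) → r ∈ ω →
                  a + b ≈ ab → b + c ≈ bc → ab + c ≈ r → a + bc ≈ r
        base : (e : M) → Empty S e → Claim e
        base e e-empty a _ b b∈ω ab ab∈ω bc _ r _ r₁ r₂ r₃
          with +-unique (+-identityʳ b∈ω e-empty) r₂ | +-unique (+-identityʳ ab∈ω e-empty) r₃
        ... | refl | refl = r₁
        step : (c s : M) → c ∈ ω → IsSucc S s c → Claim c → Claim s
        step c s c∈ω hs ih a a∈ω b b∈ω ab ab∈ω bs _ rs _ r₁ r₂ r₃ =
          let (bc , rbc , hbc) = +-suc⁻¹ hs r₂
              (r , rr , hr) = +-suc⁻¹ hs r₃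
              (_ , _ , bc∈ω) = +-∈ω rbc
          in +-suc a∈ω bc∈ω hbc hr (ih a a∈ω b b∈ω ab ab∈ω bc bc∈ω r (proj₂ (proj₂ (+-∈ω rr))) r₁ rbc rr)

      +-monoʳ-< : b ∈ b′ → a + b ≈ c → a + b′ ≈ c′ → c ∈ c′
      +-monoʳ-< {b} {b′} {a} {c} {c′} b∈b′ r r′ =
        let (a∈ω , b′∈ω , c′∈ω) = +-∈ω r′ ; (_ , _ , c∈ω) = +-∈ω r in
        ω-induction (separation (∀∈⁺ (# 0) (∀∈⁺ (# 4) (∀∈⁺ (# 5)
                      (Rel₂⁺ (# 4) (# 5) (# 2) (# 1) ⇒⁺ Rel₂⁺ (# 4) (# 5) (# 3) (# 0) ⇒⁺ # 1 ∈⁺ # 0))))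
                      (A ∷ a ∷ ω ∷ []) ω)
                    (λ e e-empty b b∈e → ⊥-elim (e-empty b b∈e)) step b′ b′∈ω b b∈b′ c c∈ω c′ c′∈ω r r′
        where
        Claim : M → Set
        Claim b′ = (b : M) → b ∈ b′ → (c : M) → c ∈ ω → (c′ : M) → c′ ∈ ω →
                   a + b ≈ c → a + b′ ≈ c′ → c ∈ c′
        step : (b′ s : M) → b′ ∈ ω → IsSucc S s b′ → Claim b′ → Claim s
        step b′ s b′∈ω hs ih b b∈s c c∈ω c′ c′∈ω r r′ with +-suc⁻¹ hs r′ | proj₁ (hs b) b∈s
        ... | d , rd , hd | inj₁ b∈b′ = succ-⊇ hd (ih b b∈b′ c c∈ω d (proj₂ (proj₂ (+-∈ω rd))) r rd)
        ... | d , rd , hd | inj₂ refl = subst (_∈ c′) (+-unique rd r) (succ-∋ hd)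

      +-cancelˡ : a + b ≈ c → a + b′ ≈ c → b ≡ b′
      +-cancelˡ r r′ with ω-trichotomy (proj₁ (proj₂ (+-∈ω r))) (proj₁ (proj₂ (+-∈ω r′)))
      ... | inj₁ b∈b′ = ⊥-elim (∈-irrefl (+-monoʳ-< b∈b′ r r′))
      ... | inj₂ (inj₁ b≡b′) = b≡b′
      ... | inj₂ (inj₂ b′∈b) = ⊥-elim (∈-irrefl (+-monoʳ-< b′∈b r′ r))

      m≤m+n : a + b ≈ c → a ≤ c
      m≤m+n r with +-∈ω r
      ... | a∈ω , b∈ω , _ with zero≤ b∈ω
      ...   | inj₁ b-empty = inj₂ (+-unique (+-identityʳ a∈ω b-empty) r)
      ...   | inj₂ ∅∈b = inj₁ (+-monoʳ-< ∅∈b (+-identityʳ a∈ω ∅-empty) r)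

      n≤m+n : a + b ≈ c → b ≤ c
      n≤m+n = m≤m+n ∘ +-comm

      ≤⇒∃+ : a ∈ ω → b ∈ ω → a ≤ b → Σ M λ d → a + d ≈ b
      ≤⇒∃+ {a} {b} a∈ω b∈ω a≤b =
        let (d , _ , r) = ω-induction (separation (∀∈⁺ (# 2) ((# 0 ∈⁺ # 1 ∨⁺ # 0 ≐⁺ # 1) ⇒⁺ ∃∈⁺ (# 3) (Rel₂⁺ (# 3) (# 1) (# 0) (# 2))))
                                (A ∷ ω ∷ []) ω)
                    base step b b∈ω a a∈ω a≤b
        in d , r
        where
        Claim : M → Set
        Claim b = (a : M) → a ∈ ω → a ≤ b → Σ M λ d → d ∈ ω × a + d ≈ b
        base : (e : M) → Empty S e → Claim e
        base e e-empty a a∈ω (inj₁ a∈e) = ⊥-elim (e-empty a a∈e)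
        base e e-empty a a∈ω (inj₂ refl) = a , a∈ω , +-identityʳ a∈ω e-empty
        step : (b s : M) → b ∈ ω → IsSucc S s b → Claim b → Claim s
        step b s b∈ω hs ih a a∈ω (inj₂ refl) = ∅ , ∅∈ω , +-identityʳ a∈ω ∅-empty
        step b s b∈ω hs ih a a∈ω (inj₁ a∈s) =
          let (d , d∈ω , r) = ih a a∈ω (proj₁ (hs a) a∈s) in
          succ d , succ∈ω d∈ω (succ-IsSucc d) , +-suc a∈ω d∈ω (succ-IsSucc d) hs r

      ·-distribˡ-+ : y · a ≈ p → y · b ≈ q → a + b ≈ s → y · s ≈ r → p + q ≈ r
      ·-distribˡ-+ {y} {a} {p} {b} {q} {s} {r} r₁ r₂ r₃ r₄ =
        let (y∈ω , a∈ω , p∈ω) = ·-∈ω r₁ ; (_ , b∈ω , q∈ω) = ·-∈ω r₂ ; (_ , s∈ω , r∈ω) = ·-∈ω r₄ in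
        ω-induction (separation (∀∈⁺ (# 4) (∀∈⁺ (# 5) (∀∈⁺ (# 6) (∀∈⁺ (# 7)
                      (Rel₂⁺ (# 5) (# 6) (# 7) (# 3) ⇒⁺ Rel₂⁺ (# 5) (# 6) (# 4) (# 2) ⇒⁺
                       Rel₂⁺ (# 9) (# 7) (# 4) (# 1) ⇒⁺ Rel₂⁺ (# 5) (# 6) (# 1) (# 0) ⇒⁺ Rel₂⁺ (# 9) (# 3) (# 2) (# 0))))))
                      (P ∷ y ∷ a ∷ ω ∷ A ∷ []) ω)
                    (base a∈ω) (step y∈ω a∈ω) b b∈ω p p∈ω q q∈ω s s∈ω r r∈ω r₁ r₂ r₃ r₄
        where
        Claim : M → Set
        Claim b = (p : M) → p ∈ ω → (q : M) → q ∈ ω → (s : M) → s ∈ ω → (r : M) → r ∈ ω →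
                  y · a ≈ p → y · b ≈ q → a + b ≈ s → y · s ≈ r → p + q ≈ r
        base : a ∈ ω → (e : M) → Empty S e → Claim e
        base a∈ω e e-empty p p∈ω q _ s _ r _ r₁ r₂ r₃ r₄
          with ·-unique (·-zeroʳ (proj₁ (·-∈ω r₁)) e-empty) r₂ | +-unique (+-identityʳ a∈ω e-empty) r₃
        ... | refl | refl with ·-unique r₁ r₄
        ... | refl = +-identityʳ p∈ω e-empty
        step : y ∈ ω → a ∈ ω → (b b′ : M) → b ∈ ω → IsSucc S b′ b → Claim b → Claim b′
        step y∈ω a∈ω b b′ b∈ω hb ih p p∈ω q′ _ s′ _ r′ _ r₁ r₂ r₃ r₄ =
          let (q , rq) = ·-total y∈ω b∈ω
              (q₂ , rq₂) = +-total (proj₂ (proj₂ (·-∈ω rq))) y∈ω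
              (s , rs , hs) = +-suc⁻¹ hb r₃
              (_ , _ , s∈ω) = +-∈ω rs
              (r , rr) = ·-total y∈ω s∈ω
              (r₂′ , rr₂) = +-total (proj₂ (proj₂ (·-∈ω rr))) y∈ω
              p+q≈r = ih p p∈ω q (proj₂ (proj₂ (·-∈ω rq))) s s∈ω r (proj₂ (proj₂ (·-∈ω rr))) r₁ rq rs rr
          in subst₂ (p +_≈_) (·-unique (·-suc hb rq rq₂) r₂) (·-unique (·-suc hs rr rr₂) r₄) (+-assoc p+q≈r rq₂ rr₂)

    one : M
    one = succ ∅

    opaque
      one∈ω : one ∈ ω
      one∈ω = succ∈ω ∅∈ω (succ-IsSucc ∅)

      ·-identityʳ : y ∈ ω → y · one ≈ y
      ·-identityʳ y∈ω = ·-suc (succ-IsSucc ∅) (·-zeroʳ y∈ω ∅-empty) (+-identityˡ y∈ω)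

      double-< : v ∈ h → v + v ≈ d → h + h ≈ e → d ∈ e
      double-< v∈h r₁ r₂ =
        let (v∈ω , _) = +-∈ω r₁ ; (h∈ω , _ , e∈ω) = +-∈ω r₂ ; (x , rx) = +-total v∈ω h∈ω in
        <-trans e∈ω (+-monoʳ-< v∈h r₁ rx) (+-monoʳ-< v∈h (+-comm rx) r₂)

      double-≤ : v ≤ h → v + v ≈ d → h + h ≈ e → d ≤ e
      double-≤ (inj₁ v∈h) r₁ r₂ = inj₁ (double-< v∈h r₁ r₂)
      double-≤ (inj₂ refl) r₁ r₂ = inj₂ (+-unique r₁ r₂)

      <-double : ∅ ∈ x → x + x ≈ d → x ∈ d
      <-double ∅∈x r = +-monoʳ-< ∅∈x (+-identityʳ (proj₁ (+-∈ω r)) ∅-empty) r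

    Half : M → M → Set
    Half u h = h + h ≈ u ⊎ Σ M λ d → d ∈ ω × h + h ≈ d × IsSucc S u d

    opaque
      half : u ∈ ω → Σ M λ h → h ∈ ω × Half u h
      half {u} = ω-induction (separation (∃∈⁺ (# 2) (Rel₂⁺ (# 2) (# 0) (# 0) (# 1) ∨⁺
                                                    ∃∈⁺ (# 3) (Rel₂⁺ (# 3) (# 1) (# 1) (# 0) ∧⁺ IsSucc⁺ (# 2) (# 0))))
                                        (A ∷ ω ∷ []) ω)
                   (λ e e-empty → ∅ , ∅∈ω , inj₁ (subst (∅ + ∅ ≈_) (sym (≡∅ e-empty)) (+-identityʳ ∅∈ω ∅-empty)))
                   step u
        where
        step : (u s : M) → u ∈ ω → IsSucc S s u → (Σ M λ h → h ∈ ω × Half u h) → Σ M λ h → h ∈ ω × Half s h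
        step u s u∈ω hs (h , h∈ω , inj₁ r) = h , h∈ω , inj₂ (u , u∈ω , r , hs)
        step u s u∈ω hs (h , h∈ω , inj₂ (d , d∈ω , r , hu)) =
          let h′∈ω = succ∈ω h∈ω (succ-IsSucc h) in
          succ h , h′∈ω , inj₁ (+-suc h′∈ω h∈ω (succ-IsSucc h) hs (+-sucˡ (succ-IsSucc h) r hu))

      half-< : ∅ ∈ u → Half u h → h ∈ u
      half-< ∅∈u (inj₂ (d , _ , r , hu)) = ≤-<-trans (succ∈ω (proj₂ (proj₂ (+-∈ω r))) hu) (m≤m+n r) (succ-∋ hu)
      half-< ∅∈u (inj₁ r) with zero≤ (proj₁ (+-∈ω r))
      ... | inj₁ h-empty = ⊥-elim (h-empty ∅ (subst (∅ ∈_) (sym (+-unique (+-identityʳ (proj₁ (+-∈ω r)) h-empty) r)) ∅∈u))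
      ... | inj₂ ∅∈h = <-double ∅∈h r

      double-half-≤ : Half u h → h + h ≈ e → e ≤ u
      double-half-≤ (inj₁ r) r′ = inj₂ (+-unique r′ r)
      double-half-≤ (inj₂ (d , _ , r , hu)) r′ = inj₁ (subst (_∈ _) (+-unique r r′) (succ-∋ hu))

      <-double-suc-half : Half u h → IsSucc S h′ h → h′ + h′ ≈ e → u ∈ e
      <-double-suc-half {u} {h} {h′} {e} hh hs r′ =
        let (h′∈ω , _ , e∈ω) = +-∈ω r′
            h∈ω = ω-transitive h′∈ω (succ-∋ hs)
            (d , rd) = +-total h∈ω h∈ω
            d∈ω = proj₂ (proj₂ (+-∈ω rd))
            h′+h≈d+1 = +-sucˡ hs rd (succ-IsSucc d)
            h′+h′≈d+2 = +-suc h′∈ω h∈ω hs (succ-IsSucc (succ d)) h′+h≈d+1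
        in subst (u ∈_) (+-unique h′+h′≈d+2 r′)
             (≤-<-trans (succ∈ω (succ∈ω d∈ω (succ-IsSucc d)) (succ-IsSucc (succ d))) (u≤d+1 rd hh) (succ-∋ (succ-IsSucc (succ d))))
        where
        u≤d+1 : h + h ≈ d → Half u h → u ≤ succ d
        u≤d+1 {d} rd (inj₁ r) = inj₁ (subst (_∈ succ d) (+-unique rd r) (succ-∋ (succ-IsSucc d)))
        u≤d+1 {d} rd (inj₂ (d′ , _ , r , hu)) with +-unique rd r
        ... | refl = inj₂ (IsSucc-unique hu (succ-IsSucc d))

      Half-∈ω : Half u h → u ∈ ω × h ∈ ω
      Half-∈ω (inj₁ r) = let (h∈ω , _ , u∈ω) = +-∈ω r in u∈ω , h∈ω
      Half-∈ω (inj₂ (d , d∈ω , r , hu)) = succ∈ω d∈ω hu , proj₁ (+-∈ω r)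

  module HereditarilyFinite (A P : M) (isAdd : IsAddGraph S ω A) (isMul : IsMulGraph S ω A P) where
    open Arithmetic A P isAdd isMul

    -- The collapse of HalvingStep on ω is the bit length: ℓ 0 = 0 and ℓ u = ℓ ⌊u/2⌋ + 1 for u > 0,
    -- because the v with 2v ≤ u are exactly the v ≤ ⌊u/2⌋.
    HalvingStep : M → M → Set
    HalvingStep v u = v ∈ u × Σ M λ d → d ∈ ω × v + v ≈ d × d ≤ u

    opaque
      BitLength-collapse : Collapse ω HalvingStep
      BitLength-collapse =
        collapse ω _ (proj₂ (relationOn ω (# 1 ∈⁺ # 0 ∧⁺ ∃∈⁺ (# 3) (Rel₂⁺ (# 3) (# 2) (# 2) (# 0) ∧⁺ (# 0 ∈⁺ # 1 ∨⁺ # 0 ≐⁺ # 1)))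
                                          (A ∷ ω ∷ [])))
                     (⊆∈⇒WellFoundedOn λ _ _ → proj₁)

    module Length = Collapse BitLength-collapse

    BitLength : M → M → Set
    BitLength = Rel S Length.π

    opaque
      bitLength-zero : BitLength ∅ k → Empty S k
      bitLength-zero r z z∈k with Length.∈-value r z∈k
      ... | v , _ , (v∈∅ , _) , _ = ∅-empty v v∈∅

      bitLength-mono : u′ ∈ ω → u ≤ u′ → BitLength u k → BitLength u′ k′ → k ⊆ₛ k′
      bitLength-mono u′∈ω u≤u′ r r′ z z∈k with Length.∈-value r z∈k
      ... | v , v∈ω , (v∈u , d , d∈ω , rd , d≤u) , πvz =
        Length.∋-value r′ v∈ω (<-≤-trans u′∈ω v∈u u≤u′ , d , d∈ω , rd , ≤-trans u′∈ω d≤u u≤u′) πvz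

      HalvingStep⇒≤half : Half u h → HalvingStep v u → v ≤ h
      HalvingStep⇒≤half {u} {h} hh (v∈u , d , _ , rd , d≤u) =
        let (u∈ω , h∈ω) = Half-∈ω hh ; (v∈ω , _) = +-∈ω rd in
        ≮⇒≥ h∈ω v∈ω λ h∈v →
          let (e , re) = +-total (succ∈ω h∈ω (succ-IsSucc h)) (succ∈ω h∈ω (succ-IsSucc h))
          in ≤⇒≯ (≤-trans u∈ω (double-≤ (<⇒succ≤ h∈ω v∈ω (succ-IsSucc h) h∈v) re rd) d≤u)
                 (<-double-suc-half hh (succ-IsSucc h) re)

      ≤half⇒HalvingStep : Half u h → h ∈ u → v ∈ ω → v ≤ h → HalvingStep v u
      ≤half⇒HalvingStep {u} {h} {v} hh h∈u v∈ω v≤h =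
        let (u∈ω , h∈ω) = Half-∈ω hh ; (d , rd) = +-total v∈ω v∈ω ; (e , re) = +-total h∈ω h∈ω in
        ≤-<-trans u∈ω v≤h h∈u , d , proj₂ (proj₂ (+-∈ω rd)) , rd , ≤-trans u∈ω (double-≤ v≤h rd re) (double-half-≤ hh re)

      -- The induction hypothesis (values below u lie in ω) makes ℓ v ⊆ ℓ h into ℓ v ≤ ℓ h.
      bitLength-half′ : Half u h → h ∈ u → BitLength h kh → BitLength u ku → kh ∈ ω →
                        ((v : M) → v ∈ u → (k : M) → BitLength v k → k ∈ ω) → IsSucc S ku kh
      bitLength-half′ {u} {h} hh h∈u rh ru kh∈ω ih z =
        (λ z∈ku → case Length.∈-value ru z∈ku of λ
          { (v , v∈ω , step , πvz) → case HalvingStep⇒≤half hh step of λ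
            { (inj₂ refl) → inj₂ (Length.unique πvz rh)
            ; (inj₁ v∈h) → ⊆⇒≤ (ih v (<-trans u∈ω v∈h h∈u) z πvz) kh∈ω (bitLength-mono h∈ω (inj₁ v∈h) πvz rh) } }) ,
        (λ { (inj₁ z∈kh) → case Length.∈-value rh z∈kh of λ
               { (v , v∈ω , (v∈h , _) , πvz) → Length.∋-value ru v∈ω (≤half⇒HalvingStep hh h∈u v∈ω (inj₁ v∈h)) πvz }
           ; (inj₂ refl) → Length.∋-value ru h∈ω (≤half⇒HalvingStep hh h∈u h∈ω (inj₂ refl)) rh })
        where
        u∈ω : u ∈ ω
        u∈ω = proj₁ (Half-∈ω hh)
        h∈ω : h ∈ ω
        h∈ω = proj₂ (Half-∈ω hh)

      bitLength-total : u ∈ ω → Σ M λ k → k ∈ ω × BitLength u k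
      bitLength-total {u} = ω-strong-induction (separation (∃∈⁺ (# 2) (Rel⁺ (# 2) (# 1) (# 0))) (Length.π ∷ ω ∷ []) ω) step u
        where
        step : (u : M) → u ∈ ω → ((v : M) → v ∈ u → Σ M λ k → k ∈ ω × BitLength v k) →
               Σ M λ k → k ∈ ω × BitLength u k
        step u u∈ω ih with Length.total u∈ω | zero≤ u∈ω
        ... | k , r | inj₁ u-empty with ≡∅ u-empty
        ...   | refl = k , subst (_∈ ω) (sym (≡∅ (bitLength-zero r))) ∅∈ω , r
        step u u∈ω ih | k , r | inj₂ ∅∈u =
          let (h , _ , hh) = half u∈ω
              h∈u = half-< ∅∈u hh
              (kh , kh∈ω , rh) = ih h h∈u
              values∈ω : (v : M) → v ∈ u → (k : M) → BitLength v k → k ∈ ω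
              values∈ω v v∈u k r = let (k′ , k′∈ω , r′) = ih v v∈u in subst (_∈ ω) (Length.unique r′ r) k′∈ω
          in k , succ∈ω kh∈ω (bitLength-half′ hh h∈u rh r kh∈ω values∈ω) , r

      bitLength-∈ω : u ∈ ω → BitLength u k → k ∈ ω
      bitLength-∈ω u∈ω r = let (k′ , k′∈ω , r′) = bitLength-total u∈ω in subst (_∈ ω) (Length.unique r′ r) k′∈ω

      bitLength-half : Half u h → h ∈ u → BitLength h kh → BitLength u ku → IsSucc S ku kh
      bitLength-half hh h∈u rh ru =
        let (u∈ω , h∈ω) = Half-∈ω hh in
        bitLength-half′ hh h∈u rh ru (bitLength-∈ω h∈ω rh) (λ v v∈u k r → bitLength-∈ω (ω-transitive u∈ω v∈u) r)

    infix 4 2^_≈_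
    -- y = 2^a is the least number of bit length a + 1.
    2^_≈_ : M → M → Set
    2^ a ≈ y = y ∈ ω × (Σ M λ k → k ∈ Length.image × (BitLength y k × IsSucc S k a)) ×
               ((v : M) → v ∈ y → (k : M) → k ∈ Length.image → BitLength v k → IsSucc S k a → ⊥)

    -- 2^ a ≈ y, for a, y, Length.π, Length.image and ω at the given positions
    2^F : {ℓ : ℕ} → Fin ℓ → Fin ℓ → Fin ℓ → Fin ℓ → Fin ℓ → Fm⁺ ℓ
    2^F a y p Y W = y ∈⁺ W ∧⁺ ∃∈⁺ Y (Rel⁺ (suc p) (suc y) (# 0) ∧⁺ IsSucc⁺ (# 0) (suc a)) ∧⁺
                    ∀∈⁺ y (∀∈⁺ (suc Y) (Rel⁺ (suc (suc p)) (# 1) (# 0) ⇒⁺ ¬⁺ IsSucc⁺ (# 0) (suc (suc a))))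

    opaque
      2^-intro : y ∈ ω → BitLength y k → IsSucc S k a →
                 ((v : M) → v ∈ y → (k′ : M) → BitLength v k′ → IsSucc S k′ a → ⊥) → 2^ a ≈ y
      2^-intro y∈ω r hk least = y∈ω , (_ , proj₂ (Length.domain r) , r , hk) , λ v v∈y k′ _ → least v v∈y k′

      2^-bitLength : 2^ a ≈ y → Σ M λ k → BitLength y k × IsSucc S k a
      2^-bitLength (_ , (k , _ , r , hk) , _) = k , r , hk

      2^-least : 2^ a ≈ y → v ∈ y → BitLength v k → IsSucc S k a → ⊥
      2^-least (_ , _ , least) v∈y r = least _ v∈y _ (proj₂ (Length.domain r)) r

      2^-∈ω : 2^ a ≈ y → a ∈ ω × y ∈ ω
      2^-∈ω (y∈ω , (k , _ , r , hk) , _) = ω-transitive (bitLength-∈ω y∈ω r) (succ-∋ hk) , y∈ω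

      2^-unique : 2^ a ≈ y → 2^ a ≈ y′ → y ≡ y′
      2^-unique p p′ with 2^-bitLength p | 2^-bitLength p′ | ω-trichotomy (proj₂ (2^-∈ω p)) (proj₂ (2^-∈ω p′))
      ... | k , r , hk | _ | inj₁ y∈y′ = ⊥-elim (2^-least p′ y∈y′ r hk)
      ... | _ | _ | inj₂ (inj₁ y≡y′) = y≡y′
      ... | _ | k′ , r′ , hk′ | inj₂ (inj₂ y′∈y) = ⊥-elim (2^-least p y′∈y r′ hk′)

      2^-positive : 2^ a ≈ y → ∅ ∈ y
      2^-positive p with 2^-bitLength p | zero≤ (proj₂ (2^-∈ω p))
      ... | k , r , hk | inj₁ y-empty with ≡∅ y-empty
      ...   | refl = ⊥-elim (bitLength-zero r _ (succ-∋ hk))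
      2^-positive p | _ | inj₂ ∅∈y = ∅∈y

      2^-zero : 2^ ∅ ≈ one
      2^-zero =
        let (k₀ , r₀) = Length.total ∅∈ω
            (k₁ , r₁) = Length.total one∈ω
            one-half : Half one ∅
            one-half = inj₂ (∅ , ∅∈ω , +-identityʳ ∅∈ω ∅-empty , succ-IsSucc ∅)
            k₁-suc = bitLength-half one-half (succ-∋ (succ-IsSucc ∅)) r₀ r₁
        in 2^-intro one∈ω r₁ (subst (IsSucc S k₁) (≡∅ (bitLength-zero r₀)) k₁-suc) λ v v∈one k′ r′ hk′ →
             case proj₁ (succ-IsSucc ∅ v) v∈one of λ
               { (inj₁ v∈∅) → ∅-empty v v∈∅
               ; (inj₂ refl) → bitLength-zero r′ ∅ (succ-∋ hk′) }

      -- A number v < 2y of bit length a + 2 would have half h with ℓ h = a + 1, so y ≤ h and 2y ≤ v.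
      2^-suc : 2^ a ≈ y → IsSucc S a′ a → y + y ≈ y₂ → 2^ a′ ≈ y₂
      2^-suc {a} {y} {a′} {y₂} p ha r =
        let (a∈ω , y∈ω) = 2^-∈ω p
            (_ , _ , y₂∈ω) = +-∈ω r
            (k , rk , hk) = 2^-bitLength p
            (k₂ , rk₂) = Length.total y₂∈ω
            k₂-suc = bitLength-half (inj₁ r) (<-double (2^-positive p) r) rk rk₂
        in 2^-intro y₂∈ω rk₂ (subst (IsSucc S k₂) (IsSucc-unique hk ha) k₂-suc) (least a∈ω y∈ω y₂∈ω)
        where
        least : a ∈ ω → y ∈ ω → y₂ ∈ ω → (v : M) → v ∈ y₂ → (k : M) → BitLength v k → IsSucc S k a′ → ⊥
        least a∈ω y∈ω y₂∈ω v v∈y₂ k rv hv with zero≤ (ω-transitive y₂∈ω v∈y₂)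
        ... | inj₁ v-empty with ≡∅ v-empty
        ...   | refl = bitLength-zero rv a′ (succ-∋ hv)
        least a∈ω y∈ω y₂∈ω v v∈y₂ k rv hv | inj₂ ∅∈v =
          let v∈ω = ω-transitive y₂∈ω v∈y₂
              (h , h∈ω , hh) = half v∈ω
              (kh , rh) = Length.total h∈ω
              kh≡a′ = IsSucc-injective (bitLength-∈ω h∈ω rh) (succ∈ω a∈ω ha) (bitLength-half hh (half-< ∅∈v hh) rh rv) hv
              y≤h = ≮⇒≥ h∈ω y∈ω λ h∈y → 2^-least p h∈y rh (subst (λ k → IsSucc S k a) (sym kh≡a′) ha)
              (e , re) = +-total h∈ω h∈ω
          in ≤⇒≯ (≤-trans v∈ω (double-≤ y≤h r re) (double-half-≤ hh re)) v∈y₂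

      2^-total : a ∈ ω → Σ M (2^ a ≈_)
      2^-total {a} a∈ω =
        let (y , _ , p) = ω-induction {P = λ a → Σ M λ y → y ∈ ω × 2^ a ≈ y}
                            (separation (∃∈⁺ (# 3) (2^F (# 1) (# 0) (# 2) (# 3) (# 4))) (Length.π ∷ Length.image ∷ ω ∷ []) ω)
                            (λ e e-empty → one , one∈ω , subst (2^_≈ one) (sym (≡∅ e-empty)) 2^-zero)
                            (λ a s _ hs (y , y∈ω , p) → let (y₂ , r) = +-total y∈ω y∈ω in
                                                        y₂ , proj₂ (proj₂ (+-∈ω r)) , 2^-suc p hs r)
                            a a∈ω
        in y , p

      <2^ : 2^ a ≈ y → a ∈ y
      <2^ {a} {y} p =
        let (a∈ω , y∈ω) = 2^-∈ω p in
        ω-induction (separation (∀∈⁺ (# 3) (2^F (# 1) (# 0) (# 2) (# 3) (# 4) ⇒⁺ # 1 ∈⁺ # 0)) (Length.π ∷ Length.image ∷ ω ∷ []) ω)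
                    base step a a∈ω y y∈ω p
        where
        base : (e : M) → Empty S e → (y : M) → y ∈ ω → 2^ e ≈ y → e ∈ y
        base e e-empty y _ p with ≡∅ e-empty
        ... | refl = subst (∅ ∈_) (2^-unique 2^-zero p) (succ-∋ (succ-IsSucc ∅))
        step : (a s : M) → a ∈ ω → IsSucc S s a → ((y : M) → y ∈ ω → 2^ a ≈ y → a ∈ y) →
               (y : M) → y ∈ ω → 2^ s ≈ y → s ∈ y
        step a s a∈ω hs ih y′ _ p′ =
          let (y , p) = 2^-total a∈ω
              (_ , y∈ω) = 2^-∈ω p
              (y₂ , r) = +-total y∈ω y∈ω
              (_ , _ , y₂∈ω) = +-∈ω r
          in subst (s ∈_) (2^-unique (2^-suc p hs r) p′)
               (≤-<-trans y₂∈ω (<⇒succ≤ a∈ω y∈ω hs (ih y y∈ω p)) (<-double (2^-positive p) r))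

      2^-mono-< : a ∈ b → 2^ a ≈ ya → 2^ b ≈ yb → ya ∈ yb
      2^-mono-< {a} {b} {ya} {yb} a∈b pa pb =
        let (_ , ya∈ω) = 2^-∈ω pa ; (b∈ω , yb∈ω) = 2^-∈ω pb in
        ω-induction (separation (∀∈⁺ (# 0) (∀∈⁺ (# 4) (∀∈⁺ (# 5)
                      (2^F (# 2) (# 1) (# 4) (# 5) (# 6) ⇒⁺ 2^F (# 3) (# 0) (# 4) (# 5) (# 6) ⇒⁺ # 1 ∈⁺ # 0))))
                      (Length.π ∷ Length.image ∷ ω ∷ []) ω)
                    (λ e e-empty a a∈e → ⊥-elim (e-empty a a∈e)) step b b∈ω a a∈b ya ya∈ω yb yb∈ω pa pb
        where
        Claim : M → Set
        Claim b = (a : M) → a ∈ b → (ya : M) → ya ∈ ω → (yb : M) → yb ∈ ω → 2^ a ≈ ya → 2^ b ≈ yb → ya ∈ yb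
        step : (b s : M) → b ∈ ω → IsSucc S s b → Claim b → Claim s
        step b s b∈ω hs ih a a∈s ya ya∈ω ys _ pa ps =
          let (yb , pb) = 2^-total b∈ω
              (_ , yb∈ω) = 2^-∈ω pb
              (y₂ , r) = +-total yb∈ω yb∈ω
              (_ , _ , y₂∈ω) = +-∈ω r
              yb∈y₂ = <-double (2^-positive pb) r
          in subst (ya ∈_) (2^-unique (2^-suc pb hs r) ps) (case proj₁ (hs a) a∈s of λ
               { (inj₁ a∈b) → <-trans y₂∈ω (ih a a∈b ya ya∈ω yb yb∈ω pa pb) yb∈y₂
               ; (inj₂ refl) → subst (_∈ y₂) (2^-unique pb pa) yb∈y₂ })

      2^-divides : b ∈ k → 2^ b ≈ yb → yb + yb ≈ Y → 2^ k ≈ yk → Σ M λ t → Y · t ≈ yk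
      2^-divides {b} {k} {yb} {Y} {yk} b∈k pb r pk =
        let (k∈ω , yk∈ω) = 2^-∈ω pk ; (_ , yb∈ω) = 2^-∈ω pb ; (_ , _ , Y∈ω) = +-∈ω r
            (t , _ , rt) = ω-induction
              (separation (∀∈⁺ (# 0) (∀∈⁺ (# 4) (∀∈⁺ (# 5) (∀∈⁺ (# 6)
                (2^F (# 3) (# 2) (# 5) (# 6) (# 7) ⇒⁺ Rel₂⁺ (# 8) (# 2) (# 2) (# 1) ⇒⁺
                 2^F (# 4) (# 0) (# 5) (# 6) (# 7) ⇒⁺ ∃∈⁺ (# 7) (Rel₂⁺ (# 10) (# 2) (# 0) (# 1)))))))
                (Length.π ∷ Length.image ∷ ω ∷ A ∷ P ∷ []) ω)
              (λ e e-empty b b∈e → ⊥-elim (e-empty b b∈e)) step k k∈ω b b∈k yb yb∈ω Y Y∈ω yk yk∈ω pb r pk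
        in t , rt
        where
        Claim : M → Set
        Claim k = (b : M) → b ∈ k → (yb : M) → yb ∈ ω → (Y : M) → Y ∈ ω → (yk : M) → yk ∈ ω →
                  2^ b ≈ yb → yb + yb ≈ Y → 2^ k ≈ yk → Σ M λ t → t ∈ ω × Y · t ≈ yk
        step : (k s : M) → k ∈ ω → IsSucc S s k → Claim k → Claim s
        step k s k∈ω hs ih b b∈s yb yb∈ω Y Y∈ω ys _ pb r ps =
          let (yk , pk) = 2^-total k∈ω
              (_ , yk∈ω) = 2^-∈ω pk
              (y₂ , r₂) = +-total yk∈ω yk∈ω
              y₂≡ys = 2^-unique (2^-suc pk hs r₂) ps
          in case proj₁ (hs b) b∈s of λ
            { (inj₁ b∈k) →
                let (t , t∈ω , rt) = ih b b∈k yb yb∈ω Y Y∈ω yk yk∈ω pb r pk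
                    (t₂ , rt₂) = +-total t∈ω t∈ω
                    (q , rq) = ·-total Y∈ω (proj₂ (proj₂ (+-∈ω rt₂)))
                in t₂ , proj₂ (proj₂ (+-∈ω rt₂)) , subst (Y · t₂ ≈_) (trans (+-unique (·-distribˡ-+ rt rt rt₂ rq) r₂) y₂≡ys) rq
            ; (inj₂ refl) → one , one∈ω , subst (Y · one ≈_) (trans (+-unique r (subst (λ y → y + y ≈ y₂) (2^-unique pk pb) r₂)) y₂≡ys)
                                                  (·-identityʳ Y∈ω) }

    -- Bit a m: the a-th binary digit of m is 1, i.e. m = 2^(a+1) q + 2^a + r with r < 2^a.
    Bit : M → M → Set
    Bit a m = Σ M λ y → y ∈ ω × (2^ a ≈ y × Σ M λ Y → Y ∈ ω × (y + y ≈ Y × Σ M λ q → q ∈ ω × Σ M λ t → t ∈ ω ×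
              (Y · q ≈ t × Σ M λ s → s ∈ ω × (t + y ≈ s × Σ M λ r → r ∈ ω × (s + r ≈ m × r ∈ y)))))

    opaque
      Bit-intro : 2^ a ≈ y → y + y ≈ Y → Y · q ≈ t → t + y ≈ s → s + r ≈ m → r ∈ y → Bit a m
      Bit-intro p rY rt rs rm r∈y =
        let (_ , y∈ω) = 2^-∈ω p ; (_ , _ , Y∈ω) = +-∈ω rY ; (_ , q∈ω , t∈ω) = ·-∈ω rt
            (_ , _ , s∈ω) = +-∈ω rs ; (_ , r∈ω , _) = +-∈ω rm
        in _ , y∈ω , p , _ , Y∈ω , rY , _ , q∈ω , _ , t∈ω , rt , _ , s∈ω , rs , _ , r∈ω , rm , r∈y

      Bit-∈ω : Bit a m → m ∈ ω
      Bit-∈ω (_ , _ , _ , _ , _ , _ , _ , _ , _ , _ , _ , _ , _ , _ , _ , _ , rm , _) = proj₂ (proj₂ (+-∈ω rm))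

      Bit⇒2^≤ : Bit a m → Σ M λ y → 2^ a ≈ y × y ≤ m
      Bit⇒2^≤ {m = m} b@(y , _ , p , _ , _ , _ , _ , _ , _ , _ , _ , _ , _ , rs , _ , _ , rm , _) =
        y , p , ≤-trans (Bit-∈ω b) (n≤m+n rs) (m≤m+n rm)

      Bit⇒< : Bit a m → a ∈ m
      Bit⇒< b = let (y , p , y≤m) = Bit⇒2^≤ b in <-≤-trans (Bit-∈ω b) (<2^ p) y≤m

      Bit-top : 2^ k ≈ yk → m ∈ yk → yk + m ≈ c → Bit k c
      Bit-top pk m∈yk rc =
        let (_ , yk∈ω) = 2^-∈ω pk ; (Y , rY) = +-total yk∈ω yk∈ω ; (_ , _ , Y∈ω) = +-∈ω rY in
        Bit-intro pk rY (·-zeroʳ Y∈ω ∅-empty) (+-identityˡ yk∈ω) rc m∈yk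

      -- With 2^k = Y t: yk + (Y q + y + r) = Y (t + q) + y + r.
      Bit-shift⁺ : b ∈ k → 2^ k ≈ yk → yk + m ≈ c → Bit b m → Bit b c
      Bit-shift⁺ b∈k pk rc (y , _ , p , Y , Y∈ω , rY , q , q∈ω , tq , tq∈ω , rtq , s , _ , rs , r , r∈ω , rm , r∈y) =
        let (t , rt) = 2^-divides b∈k p rY pk
            (_ , t∈ω , _) = ·-∈ω rt
            (q′ , rq′) = +-total t∈ω q∈ω
            (tq′ , rtq′) = ·-total Y∈ω (proj₂ (proj₂ (+-∈ω rq′)))
            (s′ , rs′) = +-total (proj₂ (proj₂ (·-∈ω rtq′))) (proj₂ (2^-∈ω p))
            (c′ , rc′) = +-total (proj₂ (proj₂ (+-∈ω rs′))) r∈ω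
            yk+m≈c′ = +-assoc (+-assoc (·-distribˡ-+ rt rtq rq′ rtq′) rs rs′) rm rc′
        in Bit-intro p rY rtq′ rs′ (subst (s′ + r ≈_) (+-unique yk+m≈c′ rc) rc′) r∈y

      -- With 2^k = Y t, c = Y q + y + r < Y (q + 1) forces t ≤ q, and then m = Y (q − t) + y + r.
      Bit-shift⁻ : b ∈ k → 2^ k ≈ yk → yk + m ≈ c → Bit b c → Bit b m
      Bit-shift⁻ {b} {k} {yk} {m} {c} b∈k pk rc (y , y∈ω , p , Y , Y∈ω , rY , q , q∈ω , tq , tq∈ω , rtq , s , _ , rs , r , r∈ω , rcc , r∈y) =
        let (t , rt) = 2^-divides b∈k p rY pk
            (_ , t∈ω , _) = ·-∈ω rt
            (q′ , rq′) = ≤⇒∃+ t∈ω q∈ω (≮⇒≥ q∈ω t∈ω (q≮t rt))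
            (tq′ , rtq′) = ·-total Y∈ω (proj₁ (proj₂ (+-∈ω rq′)))
            (s′ , rs′) = +-total (proj₂ (proj₂ (·-∈ω rtq′))) y∈ω
            (m′ , rm′) = +-total (proj₂ (proj₂ (+-∈ω rs′))) r∈ω
            yk+m′≈c = +-assoc (+-assoc (·-distribˡ-+ rt rtq′ rq′ rtq) rs′ rs) rm′ rcc
        in Bit-intro p rY rtq′ rs′ (subst (s′ + r ≈_) (+-cancelˡ yk+m′≈c rc) rm′) r∈y
        where
        q≮t : {t : M} → Y · t ≈ yk → q ∉ t
        q≮t {t} rt q∈t =
          let (_ , t∈ω , _) = ·-∈ω rt
              (_ , _ , c∈ω) = +-∈ω rcc
              (u , ru) = +-total tq∈ω Y∈ω
              (d , rd) = ≤⇒∃+ (succ∈ω q∈ω (succ-IsSucc q)) t∈ω (<⇒succ≤ q∈ω t∈ω (succ-IsSucc q) q∈t)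
              (yd , ryd) = ·-total Y∈ω (proj₁ (proj₂ (+-∈ω rd)))
              u≤yk = m≤m+n (·-distribˡ-+ (·-suc (succ-IsSucc q) rtq ru) ryd rd rt)
              (x , rx) = +-total y∈ω r∈ω
              c<u = +-monoʳ-< (+-monoʳ-< r∈y rx rY) (+-assoc rs rx rcc) ru
          in ≤⇒≯ (≤-trans c∈ω u≤yk (m≤m+n rc)) c<u

      Bit-adjoin : 2^ k ≈ yk → m ∈ yk → yk + m ≈ c → b ∈ ω → Bit b c ⟺ (Bit b m ⊎ b ≡ k)
      Bit-adjoin {k} {yk} {m} {c} {b} pk m∈yk rc b∈ω =
        let (k∈ω , yk∈ω) = 2^-∈ω pk
            (_ , m∈ω , c∈ω) = +-∈ω rc
            (y₂ , r₂) = +-total yk∈ω yk∈ω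
            c<y₂ = +-monoʳ-< m∈yk rc r₂
        in (λ bit → case ω-trichotomy b∈ω k∈ω of λ
              { (inj₁ b∈k) → inj₁ (Bit-shift⁻ b∈k pk rc bit)
              ; (inj₂ (inj₁ b≡k)) → inj₂ b≡k
              ; (inj₂ (inj₂ k∈b)) →
                  let (yb , pb , yb≤c) = Bit⇒2^≤ bit
                      p₂ = 2^-suc pk (succ-IsSucc k) r₂
                      y₂≤yb = case <⇒succ≤ k∈ω b∈ω (succ-IsSucc k) k∈b of λ
                        { (inj₁ k+1∈b) → inj₁ (2^-mono-< k+1∈b p₂ pb)
                        ; (inj₂ refl) → inj₂ (2^-unique p₂ pb) }
                  in ⊥-elim (≤⇒≯ (≤-trans c∈ω y₂≤yb yb≤c) c<y₂) }) ,
           (λ { (inj₂ refl) → Bit-top pk m∈yk rc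
              ; (inj₁ bit) → case ω-trichotomy b∈ω k∈ω of λ
                  { (inj₁ b∈k) → Bit-shift⁺ b∈k pk rc bit
                  ; (inj₂ (inj₁ refl)) → let (y , p , y≤m) = Bit⇒2^≤ bit in
                      ⊥-elim (≤⇒≯ (subst (_≤ m) (2^-unique p pk) y≤m) m∈yk)
                  ; (inj₂ (inj₂ k∈b)) → let (y , p , y≤m) = Bit⇒2^≤ bit in
                      ⊥-elim (≤⇒≯ y≤m (<-trans (proj₂ (2^-∈ω p)) m∈yk (2^-mono-< k∈b pk p))) } })

    opaque
      Bit-collapse : Collapse ω Bit
      Bit-collapse = collapse ω _ (proj₂ (relationOn ω BitF (Length.π ∷ Length.image ∷ ω ∷ A ∷ P ∷ []))) (⊆∈⇒WellFoundedOn λ _ _ → Bit⇒<)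
        where
        BitF : Fm⁺ 7
        BitF =
          ∃∈⁺ (# 4) (2^F (# 2) (# 0) (# 3) (# 4) (# 5) ∧⁺
          ∃∈⁺ (# 5) (Rel₂⁺ (# 7) (# 1) (# 1) (# 0) ∧⁺
          ∃∈⁺ (# 6) (∃∈⁺ (# 7) (Rel₂⁺ (# 10) (# 2) (# 1) (# 0) ∧⁺
          ∃∈⁺ (# 8) (Rel₂⁺ (# 10) (# 1) (# 4) (# 0) ∧⁺
          ∃∈⁺ (# 9) (Rel₂⁺ (# 11) (# 1) (# 0) (# 6) ∧⁺ # 0 ∈⁺ # 5))))))

    module Decode = Collapse Bit-collapse

    Decodes : M → M → Set
    Decodes = Rel S Decode.π

    opaque
      decode-zero : Decodes ∅ x → Empty S x
      decode-zero r u u∈x = let (b , _ , bit , _) = Decode.∈-value r u∈x in ∅-empty b (Bit⇒< bit)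

      decode-adjoin : 2^ k ≈ yk → c ∈ yk → yk + c ≈ c′ → Decodes c x → Decodes c′ x′ → Decodes k u →
                      (z : M) → z ∈ x′ ⟺ (z ∈ x ⊎ z ≡ u)
      decode-adjoin {u = u} pk c∈yk rc rx rx′ ru z =
        (λ z∈x′ → let (b , b∈ω , bit , rb) = Decode.∈-value rx′ z∈x′ in
           case proj₁ (Bit-adjoin pk c∈yk rc b∈ω) bit of λ
             { (inj₁ bit′) → inj₁ (Decode.∋-value rx b∈ω bit′ rb)
             ; (inj₂ b≡k) → inj₂ (Decode.unique rb (subst (λ b → Decodes b u) (sym b≡k) ru)) }) ,
        (λ { (inj₁ z∈x) → let (b , b∈ω , bit , rb) = Decode.∈-value rx z∈x in
                          Decode.∋-value rx′ b∈ω (proj₂ (Bit-adjoin pk c∈yk rc b∈ω) (inj₁ bit)) rb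
           ; (inj₂ refl) → let k∈ω = proj₁ (2^-∈ω pk) in
                           Decode.∋-value rx′ k∈ω (proj₂ (Bit-adjoin pk c∈yk rc k∈ω) (inj₂ refl)) ru })

      decoded-below : m ∈ ω → Σ M λ U → Transitive S U × ((y : M) → y ∈ U ⟺ Σ M λ a → a ∈ m × Decodes a y)
      decoded-below {m} m∈ω =
        let (U , hU) = separation (∃∈⁺ (# 2) (Rel⁺ (# 2) (# 0) (# 1))) (Decode.π ∷ m ∷ []) Decode.image
            U-∋ : {a y : M} → a ∈ m → Decodes a y → y ∈ U
            U-∋ a∈m r = proj₂ (hU _) (proj₂ (Decode.domain r) , _ , a∈m , r)
        in U , (λ y y∈U z z∈y → let (_ , a , a∈m , ra) = proj₁ (hU y) y∈U
                                    (b , _ , bit , rb) = Decode.∈-value ra z∈y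
                                in U-∋ (<-trans m∈ω (Bit⇒< bit) a∈m) rb) ,
           λ y → proj₂ ∘ proj₁ (hU y) , λ (a , a∈m , r) → U-∋ a∈m r

      -- Enumerate the least codes of the elements.
      coded-below⇒Finite : m ∈ ω → ((y : M) → y ∈ t → Σ M λ a → a ∈ m × Decodes a y) → Finite S t
      coded-below⇒Finite {m} {t} m∈ω coded = K , K-natural , f , (f-function , f-injective , f-surjective)
        where
        LeastCode : M → Set
        LeastCode a = (Σ M λ y → y ∈ t × Decodes a y) ×
                      ((b : M) → b ∈ a → (y : M) → y ∈ Decode.image → Decodes a y → ¬ Decodes b y)
        T-separable : Separable m LeastCode
        T-separable = separation (∃∈⁺ (# 2) (Rel⁺ (# 2) (# 1) (# 0)) ∧⁺ ∀∈⁺ (# 0) (∀∈⁺ (# 4) (Rel⁺ (# 3) (# 2) (# 0) ⇒⁺ ¬⁺ Rel⁺ (# 3) (# 1) (# 0))))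
                                 (Decode.π ∷ t ∷ Decode.image ∷ []) m
        T : M
        T = proj₁ T-separable
        T-∈ : a ∈ T → a ∈ m × LeastCode a
        T-∈ = proj₁ (proj₂ T-separable _)
        T⊆ω : a ∈ T → a ∈ ω
        T⊆ω a∈T = ω-transitive m∈ω (proj₁ (T-∈ a∈T))
        open Enumeration (enumerate m∈ω (λ a → proj₁ ∘ T-∈))
        least-code-unique : a ∈ T → a′ ∈ T → Decodes a y → Decodes a′ y → a ≡ a′
        least-code-unique {a} {a′} a∈T a′∈T r r′ with T-∈ a∈T | T-∈ a′∈T | ω-trichotomy (T⊆ω a∈T) (T⊆ω a′∈T)
        ... | _ | _ , _ , a′-least | inj₁ a∈a′ = ⊥-elim (a′-least a a∈a′ _ (proj₂ (Decode.domain r)) r′ r)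
        ... | _ | _ | inj₂ (inj₁ a≡a′) = a≡a′
        ... | _ , _ , a-least | _ | inj₂ (inj₂ a′∈a) = ⊥-elim (a-least a′ a′∈a _ (proj₂ (Decode.domain r)) r r′)
        least-code : y ∈ t → Σ M λ a → a ∈ T × Decodes a y
        least-code {y} y∈t =
          let (a , a∈m , r , a-min) = ∈-minimal (separation (Rel⁺ (# 1) (# 0) (# 2)) (Decode.π ∷ y ∷ []) m) (coded y y∈t)
          in a , proj₂ (proj₂ T-separable a) (a∈m , (y , y∈t , r) , λ b b∈a y′ _ r′ rb →
                   a-min b b∈a (<-trans m∈ω b∈a a∈m) (subst (Decodes b) (Decode.unique r′ r) rb)) , r
        K×t : M
        K×t = proj₁ (cartesian-product K t)
        K×t-product : IsProduct S K×t K t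
        K×t-product = proj₂ (cartesian-product K t)
        f-separable : Separable K×t λ z → Σ M λ i → Σ M λ y → IsOPair S z i y × Σ M λ a → a ∈ T × (Rel S σ a i × Decodes a y)
        f-separable = separation (∃⟨,⟩≐⁺ (# 0) (∃∈⁺ (# 5) (Rel⁺ (# 7) (# 0) (# 2) ∧⁺ Rel⁺ (# 8) (# 0) (# 1))))
                                 (K ∷ t ∷ T ∷ σ ∷ Decode.π ∷ []) K×t
        f : M
        f = proj₁ f-separable
        f-∈ : Rel S f i y → Σ M λ a → a ∈ T × (Rel S σ a i × Decodes a y)
        f-∈ (z , hz , z∈f) with proj₂ (proj₁ (proj₂ f-separable z) z∈f)
        ... | _ , _ , hz′ , a , a∈T , rσ , r with IsOPair-injective hz hz′
        ... | refl , refl = a , a∈T , rσ , r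
        f-∋ : i ∈ K → y ∈ t → a ∈ T → Rel S σ a i → Decodes a y → Rel S f i y
        f-∋ {i} {y} i∈K y∈t a∈T rσ r = let (z , hz) = opair i y in
          z , hz , proj₂ (proj₂ f-separable z) (product-∋ K×t-product i∈K y∈t hz , i , y , hz , _ , a∈T , rσ , r)
        f-function : IsFunction S f K t
        f-function =
          (λ z z∈f → proj₁ (K×t-product z) (proj₁ (proj₁ (proj₂ f-separable z) z∈f))) ,
          (λ i i∈K → let (a , a∈T , rσ) = σ-surjective i i∈K
                         ((y , y∈t , r) , _) = proj₂ (T-∈ a∈T)
                     in y , f-∋ i∈K y∈t a∈T rσ r) ,
          (λ i y y′ fiy fiy′ → let (a , a∈T , rσ , r) = f-∈ fiy ; (a′ , a′∈T , rσ′ , r′) = f-∈ fiy′ in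
                               Decode.unique r (subst (λ a → Decodes a y′) (sym (σ-injective a∈T a′∈T rσ rσ′)) r′))
        f-injective : (i i′ y : M) → Rel S f i y → Rel S f i′ y → i ≡ i′
        f-injective i i′ y fiy fi′y = let (a , a∈T , rσ , r) = f-∈ fiy ; (a′ , a′∈T , rσ′ , r′) = f-∈ fi′y in
          σ-unique rσ (subst (λ a → Rel S σ a i′) (sym (least-code-unique a∈T a′∈T r r′)) rσ′)
        f-surjective : (y : M) → y ∈ t → Σ M λ i → Rel S f i y
        f-surjective y y∈t = let (a , a∈T , r) = least-code y∈t ; (i , i∈K , rσ) = σ-total a a∈T in
          i , f-∋ i∈K y∈t a∈T rσ r

      decode-HF : m ∈ ω → Decodes m x → HF S x
      decode-HF {m} {x} m∈ω r with transitive-closure x | decoded-below m∈ω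
      ... | t , tc@(_ , _ , t-least) | U , U-transitive , hU =
        t , tc , coded-below⇒Finite m∈ω λ y y∈t → proj₁ (hU y) (t-least U U-transitive x⊆U y y∈t)
        where
        x⊆U : x ⊆ₛ U
        x⊆U z z∈x = let (b , _ , bit , rb) = Decode.∈-value r z∈x in proj₂ (hU z) (b , Bit⇒< bit , rb)

    opaque
      V-separable : Separable Decode.image λ x → Σ M λ m → m ∈ ω × Decodes m x
      V-separable = separation (∃∈⁺ (# 2) (Rel⁺ (# 2) (# 0) (# 1))) (Decode.π ∷ ω ∷ []) Decode.image

    V : M
    V = proj₁ V-separable

    opaque
      V-∈ : x ∈ V → Σ M λ m → m ∈ ω × Decodes m x
      V-∈ x∈V = proj₂ (proj₁ (proj₂ V-separable _) x∈V)

      V-∋ : m ∈ ω → Decodes m x → x ∈ V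
      V-∋ m∈ω r = proj₂ (proj₂ V-separable _) (proj₂ (Decode.domain r) , _ , m∈ω , r)

    -- c < 2^k decodes to the set of those elements of x that have a code below k.
    CodesBelow : M → M → Set
    CodesBelow x k = Σ M λ c → c ∈ ω × Σ M λ yk → yk ∈ ω × (2^ k ≈ yk × (c ∈ yk × Σ M λ q → q ∈ Decode.image × (Decodes c q ×
                     (((u : M) → u ∈ q → u ∈ x × Σ M λ a → a ∈ k × Decodes a u) ×
                      ((u : M) → u ∈ x → (a : M) → a ∈ k → Decodes a u → u ∈ q)))))

    opaque
      codesBelow : k ∈ ω → CodesBelow x k
      codesBelow {k} {x} = ω-induction
        (separation (∃∈⁺ (# 1) (∃∈⁺ (# 2) (2^F (# 2) (# 0) (# 4) (# 5) (# 3) ∧⁺ # 1 ∈⁺ # 0 ∧⁺ ∃∈⁺ (# 7) (Rel⁺ (# 7) (# 2) (# 0) ∧⁺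
           ∀∈⁺ (# 0) (# 0 ∈⁺ # 10 ∧⁺ ∃∈⁺ (# 4) (Rel⁺ (# 9) (# 0) (# 1))) ∧⁺
           ∀∈⁺ (# 9) (∀∈⁺ (# 4) (Rel⁺ (# 9) (# 0) (# 1) ⇒⁺ # 1 ∈⁺ # 2))))))
          (ω ∷ Length.π ∷ Length.image ∷ Decode.π ∷ Decode.image ∷ x ∷ []) ω)
        base step k
        where
        base : (e : M) → Empty S e → CodesBelow x e
        base e e-empty with ≡∅ e-empty
        ... | refl = let (q , r) = Decode.total ∅∈ω in
          ∅ , ∅∈ω , one , one∈ω , 2^-zero , succ-∋ (succ-IsSucc ∅) , q , proj₂ (Decode.domain r) , r ,
          (λ u u∈q → ⊥-elim (decode-zero r u u∈q)) , (λ u _ a a∈∅ → ⊥-elim (∅-empty a a∈∅))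
        step : (k s : M) → k ∈ ω → IsSucc S s k → CodesBelow x k → CodesBelow x s
        step k s k∈ω hs (c , c∈ω , yk , yk∈ω , pk , c∈yk , q , q∈Y , rq , q⊆ , ⊆q) =
          let (y₂ , r₂) = +-total yk∈ω yk∈ω ; (_ , _ , y₂∈ω) = +-∈ω r₂ ; ps = 2^-suc pk hs r₂ in
          case lem (Σ M λ u → u ∈ x × Decodes k u) of λ
            { (inj₁ (u₀ , u₀∈x , ru₀)) →
                let (c′ , rc′) = +-total yk∈ω c∈ω
                    (q′ , rq′) = Decode.total (proj₂ (proj₂ (+-∈ω rc′)))
                    adjoined = decode-adjoin pk c∈yk rc′ rq rq′ ru₀
                in c′ , proj₂ (proj₂ (+-∈ω rc′)) , y₂ , y₂∈ω , ps , +-monoʳ-< c∈yk rc′ r₂ ,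
                   q′ , proj₂ (Decode.domain rq′) , rq′ ,
                   (λ u u∈q′ → case proj₁ (adjoined u) u∈q′ of λ
                     { (inj₁ u∈q) → let (u∈x , a , a∈k , ra) = q⊆ u u∈q in u∈x , a , succ-⊇ hs a∈k , ra
                     ; (inj₂ refl) → u₀∈x , k , succ-∋ hs , ru₀ }) ,
                   (λ u u∈x a a∈s ra → case proj₁ (hs a) a∈s of λ
                     { (inj₁ a∈k) → proj₂ (adjoined u) (inj₁ (⊆q u u∈x a a∈k ra))
                     ; (inj₂ refl) → proj₂ (adjoined u) (inj₂ (Decode.unique ra ru₀)) })
            ; (inj₂ none) →
                c , c∈ω , y₂ , y₂∈ω , ps , <-trans y₂∈ω c∈yk (<-double (2^-positive pk) r₂) , q , q∈Y , rq ,
                (λ u u∈q → let (u∈x , a , a∈k , ra) = q⊆ u u∈q in u∈x , a , succ-⊇ hs a∈k , ra) ,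
                (λ u u∈x a a∈s ra → case proj₁ (hs a) a∈s of λ
                  { (inj₁ a∈k) → ⊆q u u∈x a a∈k ra ; (inj₂ refl) → ⊥-elim (none (u , u∈x , ra)) }) }

      codes-bounded : {f : M} → ((i y y′ : M) → Rel S f i y → Rel S f i y′ → y ≡ y′) → x ⊆ₛ V → j ∈ ω →
                      Σ M λ N → N ∈ ω ×
                        ((i : M) → i ∈ j → (y : M) → y ∈ x → Rel S f i y → Σ M λ a → a ∈ N × Decodes a y)
      codes-bounded {x = x} {j = j} {f = f} f-functional x⊆V = ω-induction
        (separation (∃∈⁺ (# 1) (∀∈⁺ (# 1) (∀∈⁺ (# 4) (Rel⁺ (# 6) (# 1) (# 0) ⇒⁺ ∃∈⁺ (# 2) (Rel⁺ (# 8) (# 0) (# 1))))))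
                    (ω ∷ x ∷ f ∷ Decode.π ∷ []) ω)
        (λ e e-empty → ∅ , ∅∈ω , λ i i∈e → ⊥-elim (e-empty i i∈e))
        step j
        where
        Bound : M → M → Set
        Bound j N = (i : M) → i ∈ j → (y : M) → y ∈ x → Rel S f i y → Σ M λ a → a ∈ N × Decodes a y
        step : (j s : M) → j ∈ ω → IsSucc S s j → (Σ M λ N → N ∈ ω × Bound j N) → Σ M λ N → N ∈ ω × Bound s N
        step j s j∈ω hs (N , N∈ω , bound) with lem (Σ M λ y → y ∈ x × Rel S f j y)
        ... | inj₂ none = N , N∈ω , λ i i∈s y y∈x r → case proj₁ (hs i) i∈s of λ
              { (inj₁ i∈j) → bound i i∈j y y∈x r ; (inj₂ refl) → ⊥-elim (none (y , y∈x , r)) }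
        ... | inj₁ (y₀ , y₀∈x , r₀) =
          let (a₀ , a₀∈ω , ra₀) = V-∈ (x⊆V y₀ y₀∈x)
              a₀+1∈ω = succ∈ω a₀∈ω (succ-IsSucc a₀)
              (N′ , N′∈ω , N⊆N′ , a₀∈N′) = larger N∈ω a₀+1∈ω (succ-∋ (succ-IsSucc a₀))
          in N′ , N′∈ω , λ i i∈s y y∈x r → case proj₁ (hs i) i∈s of λ
               { (inj₁ i∈j) → let (a , a∈N , ra) = bound i i∈j y y∈x r in a , N⊆N′ a a∈N , ra
               ; (inj₂ refl) → a₀ , a₀∈N′ , subst (Decodes a₀) (f-functional j y₀ y r₀ r) ra₀ }
          where
          larger : {K b a : M} → K ∈ ω → b ∈ ω → a ∈ b → Σ M λ K′ → K′ ∈ ω × K ⊆ₛ K′ × a ∈ K′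
          larger {K} {b} K∈ω b∈ω a∈b with ω-trichotomy K∈ω b∈ω
          ... | inj₁ K∈b = b , b∈ω , (λ c c∈K → <-trans b∈ω c∈K K∈b) , a∈b
          ... | inj₂ (inj₁ refl) = K , K∈ω , (λ c c∈K → c∈K) , a∈b
          ... | inj₂ (inj₂ b∈K) = K , K∈ω , (λ c c∈K → c∈K) , <-trans K∈ω a∈b b∈K

      finite-⊆V⇒∈V : {f : M} → n ∈ ω → IsFunction S f n t → ((y : M) → y ∈ t → Σ M λ i → Rel S f i y) →
                     x ⊆ₛ t → x ⊆ₛ V → x ∈ V
      finite-⊆V⇒∈V {n = n} {t = t} {x = x} {f = f} n∈ω (f-on , _ , f-functional) f-onto x⊆t x⊆V =
        let (N , N∈ω , bound) = codes-bounded f-functional x⊆V n∈ω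
            (c , c∈ω , _ , _ , _ , _ , q , _ , rq , q⊆x , x⊆q) = codesBelow {x = x} N∈ω
            code : (u : M) → u ∈ x → Σ M λ a → a ∈ N × Decodes a u
            code u u∈x = let (i , r) = f-onto u (x⊆t u u∈x) in bound i (domain r) u u∈x r
        in V-∋ c∈ω (subst (Decodes c) (extensionality q x λ u →
             (λ u∈q → proj₁ (q⊆x u u∈q)) , (λ u∈x → let (a , a∈N , ra) = code u u∈x in x⊆q u u∈x a a∈N ra)) rq)
        where
        domain : Rel S f i y → i ∈ n
        domain (z , hz , z∈f) = let (_ , _ , i∈n , _ , hz′) = f-on z z∈f in subst (_∈ n) (sym (proj₁ (IsOPair-injective hz hz′))) i∈n

      -- ∈-induction on the transitive set tc(z) ∪ {z}, whose elements are finite subsets of tc(z).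
      HF⇒∈V : HF S z → z ∈ V
      HF⇒∈V {z} (t , (t-transitive , z⊆t , _) , n , n-natural , f , (f-function , _ , f-onto)) =
        let (s , hs) = pair z z
            (Z , hZ) = binaryUnion t s
            ⊆t : x ∈ Z → x ⊆ₛ t
            ⊆t {x} x∈Z = case proj₁ (hZ x) x∈Z of λ
              { (inj₁ x∈t) → t-transitive x x∈t
              ; (inj₂ x∈s) → subst (_⊆ₛ t) (sym (singleton-∈ hs x∈s)) z⊆t }
        in ∈-induction (separation (# 0 ∈⁺ # 1) (V ∷ []) Z)
             (λ x x∈Z ih → finite-⊆V⇒∈V (NaturalNumber⇒∈ω n-natural) f-function f-onto (⊆t x∈Z)
                             λ y y∈x → ih y y∈x (proj₂ (hZ y) (inj₁ (⊆t x∈Z y y∈x))))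
             z (proj₂ (hZ z) (inj₂ (pair-∋ˡ hs)))

      V-isVω : IsVω S V
      V-isVω z = (λ z∈V → let (m , m∈ω , r) = V-∈ z∈V in decode-HF m∈ω r) , HF⇒∈V

mainTheorem19 : LEM → (S : Structure) → IsCx S →
    Σ (Structure.M S) λ w → IsOmega S w ×
    Σ (Structure.M S) λ A → IsAddGraph S w A ×
    Σ (Structure.M S) λ P → IsMulGraph S w A P ×
    Σ (Structure.M S) λ V → IsVω S V
mainTheorem19 lem S cx =
  ω , ω-isOmega , A , A-isAddGraph , P , P-isMulGraph , V , V-isVω
  where
  open Construction lem S cx
  open Multiplication A A-isAddGraph
  open HereditarilyFinite A P A-isAddGraph P-isMulGraph
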